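{- Let $\Gamma$ be a finite $L$-regular triangle-free simplicial graph with $n$ vertices, let $N\ge3$ be an integer, and let $(\Gamma,N)$ be the numbered graph with all vertex numbers equal to $N$. Put $K=\lfloor N/2\rfloor$. Let $\mathcal{G}(z)$ be the geodesic growth series of $\mathrm{NGP}(\Gamma,N)$. For $1\le k\le K$ let $\mathcal{G}_k(z)=\sum_{v\in V\Gamma}\Delta_{v^k}(z)$, and for $1\le k,\ell\le K$ let $\mathcal{G}_{\{k,\ell\}}(z)=\sum_{(u,v)}\Delta_{u^k v^\ell}(z)$, the sum over all ordered pairs $(u,v)$ of adjacent vertices; set $\mathcal{G}_{K+1}(z)=0$ and $\mathcal{G}_{\{k,\ell\}}(z)=0$ whenever $k=K+1$ or $\ell=K+1$. Then for all $1\le k,\ell\le K$: \begin{align*} \mathcal{G}(z)&=2z\,\mathcal{G}_1(z)+1,\\ \mathcal{G}_k(z)&=z\big(\mathcal{G}_{k+1}(z)+2\mathcal{G}_{\{1,k\}}(z)+2(n-L-1)\mathcal{G}_1(z)\big)+n,\\ \mathcal{G}_{\{k,\ell\}}(z)&=z\big(\mathcal{G}_{\{k+1,\ell\}}(z)+\mathcal{G}_{\{k,\ell+1\}}(z)+2(L-1)(\mathcal{G}_{\{1,k\}}(z)+\mathcal{G}_{\{1,\ell\}}(z))+2L(n-2L)\mathcal{G}_1(z)\big)+nL. \end{align*}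
   Context: For a numbered graph $(\Gamma,N)$ (finite simplicial graph with a map $N:V\Gamma\to\{2,3,\dots\}$; here $N$ is constant), $\mathrm{NGP}(\Gamma,N)=\langle v\in V\Gamma\mid v^{N(v)}=1,\ uv=vu\text{ for }\{u,v\}\in E\Gamma\rangle$ with standard generating set $S=V\Gamma\cup(V\Gamma)^{ -1}$. A word over $S$ is geodesic if no shorter word over $S$ represents the same element; the geodesic growth series is $\sum_m a_m z^m$ with $a_m$ the number of geodesic words of length $m$. $L$-regular means every vertex has exactly $L$ neighbours; triangle-free means no three pairwise adjacent vertices. For a vertex $v$ and $1\le k\le K$, $\Delta_{v^k}(z)=\sum_m c_m z^m$ where $c_m$ is the number of words $x\in S^m$ such that the word $v^k x$ is geodesic; for adjacent $u,v$ and $1\le k,\ell\le K$, $\Delta_{u^kv^\ell}(z)$ is defined likewise using the words $x$ such that $u^kv^\ell x$ is geodesic. -}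

module Defs where

open import Data.Nat using (ℕ; zero; suc; _+_; _*_; _<_; _≤_; _≤ᵇ_; ⌊_/2⌋)
open import Data.Bool using (Bool; true; false; not; if_then_else_; _∧_)
open import Data.Fin using (Fin)
import Data.Fin
import Data.Product
open import Data.List using (List; []; _∷_; _++_; length; replicate)
open import Data.Product using (_×_; ∃)
open import Data.Empty using (⊥)
open import Relation.Binary.PropositionalEquality using (_≡_)
open import Relation.Binary.Construct.Closure.Equivalence using (EqClosure)

sumFin : (n : ℕ) → (Fin n → ℕ) → ℕ
sumFin zero    f = 0
sumFin (suc n) f = f Data.Fin.zero + sumFin n (λ i → f (Data.Fin.suc i))

Adjacency : ℕ → Set
Adjacency n = Fin n → Fin n → Bool

IsSimple : (n : ℕ) → Adjacency n → Set
IsSimple n adj = (∀ u v → adj u v ≡ adj v u) × (∀ v → adj v v ≡ false)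

degree : (n : ℕ) → Adjacency n → Fin n → ℕ
degree n adj v = sumFin n (λ u → if adj v u then 1 else 0)

IsRegular : (n : ℕ) → Adjacency n → ℕ → Set
IsRegular n adj L = ∀ v → degree n adj v ≡ L

TriangleFree : (n : ℕ) → Adjacency n → Set
TriangleFree n adj =
  ∀ u v w → adj u v ≡ true → adj v w ≡ true → adj u w ≡ true → ⊥

-- Generators S = V ∪ V⁻¹ : (v , true) is v, (v , false) is v⁻¹.
Gen : ℕ → Set
Gen n = Fin n × Bool

Word : ℕ → Set
Word n = List (Gen n)

-- Defining relators of NGP(Γ,N) (all vertex numbers equal to N),
-- together with free cancellation.
data Rule (n : ℕ) (adj : Adjacency n) (N : ℕ) : Word n → Word n → Set where
  cancel : ∀ v b → Rule n adj N ((v Data.Product., b) ∷ (v Data.Product., not b) ∷ []) []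
  power  : ∀ v → Rule n adj N (replicate N (v Data.Product., true)) []
  commute : ∀ u v → adj u v ≡ true →
    Rule n adj N ((u Data.Product., true) ∷ (v Data.Product., true) ∷ [])
                 ((v Data.Product., true) ∷ (u Data.Product., true) ∷ [])

data Step (n : ℕ) (adj : Adjacency n) (N : ℕ) : Word n → Word n → Set where
  step : ∀ xs ys {l r} → Rule n adj N l r → Step n adj N (xs ++ l ++ ys) (xs ++ r ++ ys)

SameElement : (n : ℕ) → Adjacency n → ℕ → Word n → Word n → Set
SameElement n adj N = EqClosure (Step n adj N)

Geodesic : (n : ℕ) → Adjacency n → ℕ → Word n → Set
Geodesic n adj N w = ∀ w' → length w' < length w → SameElement n adj N w' w → ⊥

record Count {A : Set} (P : A → Set) (c : ℕ) : Set where
  field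
    enum     : Fin c → A
    inj      : ∀ i j → enum i ≡ enum j → i ≡ j
    sound    : ∀ i → P (enum i)
    complete : ∀ w → P w → ∃ λ i → enum i ≡ w

pow : {n : ℕ} → Fin n → ℕ → Word n
pow v k = replicate k (v Data.Product., true)

-- Coefficients of the series G_k (with G_{K+1} = 0), given the coefficient
-- functions d v k m of Δ_{v^k}.
Gser : (n K : ℕ) → (Fin n → ℕ → ℕ → ℕ) → ℕ → ℕ → ℕ
Gser n K d k m = if k ≤ᵇ K then sumFin n (λ v → d v k m) else 0

-- Coefficients of G_{k,ℓ} (zero if k or ℓ is K+1), given coefficients
-- e u v k ℓ m of Δ_{u^k v^ℓ}; sum over ordered adjacent pairs.
Gpair : (n : ℕ) → Adjacency n → (K : ℕ) → (Fin n → Fin n → ℕ → ℕ → ℕ → ℕ) →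
        ℕ → ℕ → ℕ → ℕ
Gpair n adj K e k l m =
  if (k ≤ᵇ K) ∧ (l ≤ᵇ K)
  then sumFin n (λ u → sumFin n (λ v → if adj u v then e u v k l m else 0))
  else 0

-- Every element has a normal form: a list of syllables v^e (0 < e < N), unique up to swapping adjacent
-- commuting syllables and computed by letting the generators act on such lists.  Its cost
-- Σ min(e, N - e) is the length of the element, so a word is geodesic exactly when its length equals
-- that cost; geodesicity is thus decidable, and coefficients are computed by branching on the first
-- letter.  After a geodesic prefix v^k (or u^k v^l with u, v adjacent) the next letter w^±1 either
-- lengthens a power, or w neighbours a prefix vertex and commutes to the front of its power while the
-- rest of the prefix (not adjacent to w, by triangle-freeness) blocks it and can be dropped, or the whole
-- prefix blocks w and can be dropped.  Inverting w is an automorphism, so w and w⁻¹ contribute equally;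
-- summing over vertices and edges, L-regularity and triangle-freeness give the multiplicities
-- n - L - 1, L - 1 and L(n - 2L).
module Submission where

open import Defs
open import Data.Nat using (ℕ; zero; suc; _+_; _*_; _∸_; _≤_; _<_; z≤n; s≤s; _⊓_; _≡ᵇ_; _≤ᵇ_; ⌊_/2⌋)
open import Data.Nat.Properties hiding (_≟_)
open import Data.Nat.DivMod using (_%_; _/_; m≡m%n+[m/n]*n; m%n<n; n%n≡0; %-distribˡ-+; m%n%n≡m%n; m<n⇒m%n≡m; [m+n]%n≡m%n)
open import Data.Fin as Fin using (Fin; _≟_; splitAt; _↑ˡ_; _↑ʳ_; join)
open import Data.Fin.Properties using (splitAt-↑ˡ; splitAt-↑ʳ; join-splitAt; injective⇒≤) renaming (suc-injective to Fin-suc-injective)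
open import Data.Bool using (Bool; true; false; not; T; _∧_; if_then_else_)
open import Data.Bool.Properties using (¬-not; ∧-identityʳ; not-involutive; T-≡)
open import Function.Bundles using (Equivalence)
open import Data.Unit using (tt)
open import Data.List using (List; []; _∷_; _++_; length; replicate; map)
open import Data.List.Properties using (++-assoc; ++-identityʳ; length-++; length-replicate; length-map; map-++; map-replicate)
open import Data.List.Relation.Unary.All using (All; []; _∷_)
open import Data.List.Relation.Unary.All.Properties using (replicate⁺)
open import Data.Product using (_×_; _,_; proj₁; proj₂; ∃; Σ)
open import Data.Sum using (_⊎_; inj₁; inj₂; [_,_]′)
open import Data.Empty using (⊥; ⊥-elim)
open import Relation.Nullary using (yes; no)
open import Relation.Binary.PropositionalEquality
open import Relation.Binary.Construct.Closure.ReflexiveTransitive using (ε; _◅_; _◅◅_; gmap)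
open import Relation.Binary.Construct.Closure.Symmetric using (SymClosure; fwd; bwd)
import Relation.Binary.Construct.Closure.Equivalence as EqClosure
open import Data.Nat.Tactic.RingSolver using (solve-∀)

replicate-snoc : ∀ {A : Set} (x : A) j → replicate (suc j) x ≡ replicate j x ++ x ∷ []
replicate-snoc x zero = refl
replicate-snoc x (suc j) = cong (x ∷_) (replicate-snoc x j)

module WordEquality (n : ℕ) (adj : Adjacency n) (N' : ℕ)
                    (adj-sym : ∀ u v → adj u v ≡ adj v u) where

  N : ℕ
  N = suc N'

  infix 4 _~_
  _~_ : Word n → Word n → Set
  _~_ = SameElement n adj N

  ~-sym : ∀ {a b} → a ~ b → b ~ a
  ~-sym = EqClosure.symmetric (Step n adj N)

  ≡⇒~ : ∀ {a b} → a ≡ b → a ~ b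
  ≡⇒~ refl = ε

  ~-wrap : ∀ p q {a b} → a ~ b → (p ++ a ++ q) ~ (p ++ b ++ q)
  ~-wrap p q = gmap (λ w → p ++ w ++ q) wrap
    where
    shift : ∀ xs l ys → (p ++ xs) ++ l ++ ys ++ q ≡ p ++ (xs ++ l ++ ys) ++ q
    shift xs l ys = trans (++-assoc p xs (l ++ ys ++ q))
      (cong (p ++_) (trans (cong (xs ++_) (sym (++-assoc l ys q))) (sym (++-assoc xs (l ++ ys) q))))
    wrapStep : ∀ {a b} → Step n adj N a b → Step n adj N (p ++ a ++ q) (p ++ b ++ q)
    wrapStep (step xs ys {l} {r} ρ) =
      subst₂ (Step n adj N) (shift xs l ys) (shift xs r ys) (step (p ++ xs) (ys ++ q) ρ)
    wrap : ∀ {a b} → SymClosure (Step n adj N) a b → SymClosure (Step n adj N) (p ++ a ++ q) (p ++ b ++ q)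
    wrap (fwd s) = fwd (wrapStep s)
    wrap (bwd s) = bwd (wrapStep s)

  ~-++ˡ : ∀ p {a b} → a ~ b → (p ++ a) ~ (p ++ b)
  ~-++ˡ p {a} {b} s =
    subst₂ _~_ (cong (p ++_) (++-identityʳ a)) (cong (p ++_) (++-identityʳ b)) (~-wrap p [] s)

  ~-++ʳ : ∀ q {a b} → a ~ b → (a ++ q) ~ (b ++ q)
  ~-++ʳ q = ~-wrap [] q

  rule⇒~ : ∀ {l r} → Rule n adj N l r → l ~ r
  rule⇒~ {l} {r} ρ = fwd (subst₂ (Step n adj N) (++-identityʳ l) (++-identityʳ r) (step [] [] ρ)) ◅ ε

  gen⁺ gen⁻ : Fin n → Gen n
  gen⁺ v = (v , true)
  gen⁻ v = (v , false)

  cancel~ : ∀ v b → (v , b) ∷ (v , not b) ∷ [] ~ []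
  cancel~ v b = rule⇒~ (cancel v b)

  cancel′~ : ∀ v b → (v , not b) ∷ (v , b) ∷ [] ~ []
  cancel′~ v true = rule⇒~ (cancel v false)
  cancel′~ v false = rule⇒~ (cancel v true)

  commute⁻⁺~ : ∀ u v → adj u v ≡ true → gen⁻ u ∷ gen⁺ v ∷ [] ~ gen⁺ v ∷ gen⁻ u ∷ []
  commute⁻⁺~ u v uv =
    ~-wrap (gen⁻ u ∷ gen⁺ v ∷ []) [] (~-sym (cancel~ u true))
    ◅◅ ~-wrap (gen⁻ u ∷ []) (gen⁻ u ∷ []) (rule⇒~ (commute v u (trans (adj-sym v u) uv)))
    ◅◅ ~-wrap [] (gen⁺ v ∷ gen⁻ u ∷ []) (cancel~ u false)

  commute~ : ∀ u v b c → adj u v ≡ true → (u , b) ∷ (v , c) ∷ [] ~ (v , c) ∷ (u , b) ∷ []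
  commute~ u v true true uv = rule⇒~ (commute u v uv)
  commute~ u v false true uv = commute⁻⁺~ u v uv
  commute~ u v true false uv = ~-sym (commute⁻⁺~ v u (trans (adj-sym v u) uv))
  commute~ u v false false uv =
    ~-wrap [] (gen⁻ u ∷ gen⁻ v ∷ []) (~-sym (cancel′~ v true))
    ◅◅ ~-wrap (gen⁻ v ∷ []) (gen⁻ v ∷ []) (~-sym (commute⁻⁺~ u v uv))
    ◅◅ ~-wrap (gen⁻ v ∷ gen⁻ u ∷ []) [] (cancel~ v true)

  CommutesWith : Fin n → Word n → Set
  CommutesWith u X = All (λ t → adj u (proj₁ t) ≡ true) X

  letter-commutes : ∀ s X → CommutesWith (proj₁ s) X → (s ∷ X) ~ (X ++ s ∷ [])
  letter-commutes s [] [] = ε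
  letter-commutes (u , b) ((w , c) ∷ X) (uw ∷ uX) =
    ~-wrap [] X (commute~ u w b c uw) ◅◅ ~-++ˡ ((w , c) ∷ []) (letter-commutes (u , b) X uX)

  word-commutes : ∀ A X → All (λ s → CommutesWith (proj₁ s) X) A → (A ++ X) ~ (X ++ A)
  word-commutes [] X [] = ≡⇒~ (sym (++-identityʳ X))
  word-commutes (s ∷ A) X (sX ∷ AX) =
    ~-++ˡ (s ∷ []) (word-commutes A X AX)
    ◅◅ subst ((s ∷ X ++ A) ~_) (++-assoc X (s ∷ []) A) (~-++ʳ A (letter-commutes s X sX))

  pow-+ : ∀ (v : Fin n) a b → pow v (a + b) ≡ pow v a ++ pow v b
  pow-+ v zero b = refl
  pow-+ v (suc a) b = cong (gen⁺ v ∷_) (pow-+ v a b)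

  pow-N~[] : ∀ v → pow v N ~ []
  pow-N~[] v = rule⇒~ (power v)

  pow-+*N~ : ∀ v a k → pow v (a + k * N) ~ pow v a
  pow-+*N~ v a zero = ≡⇒~ (cong (pow v) (+-identityʳ a))
  pow-+*N~ v a (suc k) =
    ≡⇒~ (trans (pow-+ v a (N + k * N)) (cong (pow v a ++_) (pow-+ v N (k * N))))
    ◅◅ ~-wrap (pow v a) (pow v (k * N)) (pow-N~[] v)
    ◅◅ ≡⇒~ (sym (pow-+ v a (k * N)))
    ◅◅ pow-+*N~ v a k

  pow~pow-mod : ∀ v a → pow v a ~ pow v (a % N)
  pow~pow-mod v a = ≡⇒~ (cong (pow v) (m≡m%n+[m/n]*n a N)) ◅◅ pow-+*N~ v (a % N) (a / N)

  inverse-pow-cancel : ∀ v j → replicate j (gen⁻ v) ++ pow v j ~ []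
  inverse-pow-cancel v zero = ε
  inverse-pow-cancel v (suc j) =
    ≡⇒~ (trans (cong (_++ pow v (suc j)) (replicate-snoc (gen⁻ v) j))
               (++-assoc (replicate j (gen⁻ v)) (gen⁻ v ∷ []) (pow v (suc j))))
    ◅◅ ~-wrap (replicate j (gen⁻ v)) (pow v j) (cancel′~ v true)
    ◅◅ inverse-pow-cancel v j

  inverse-pow~pow : ∀ v j → j ≤ N → replicate j (gen⁻ v) ~ pow v (N ∸ j)
  inverse-pow~pow v j j≤N =
    ≡⇒~ (sym (++-identityʳ (replicate j (gen⁻ v))))
    ◅◅ ~-++ˡ (replicate j (gen⁻ v)) (~-sym (pow-N~[] v))
    ◅◅ ≡⇒~ (cong (λ z → replicate j (gen⁻ v) ++ pow v z) (sym (m+[n∸m]≡n j≤N)))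
    ◅◅ ≡⇒~ (cong (replicate j (gen⁻ v) ++_) (pow-+ v j (N ∸ j)))
    ◅◅ ≡⇒~ (sym (++-assoc (replicate j (gen⁻ v)) (pow v j) (pow v (N ∸ j))))
    ◅◅ ~-++ʳ (pow v (N ∸ j)) (inverse-pow-cancel v j)

true≢false : ∀ {b} → b ≡ true → b ≡ false → ⊥
true≢false refl ()

≢⇒≡ᵇ-false : ∀ a b → a ≢ b → (a ≡ᵇ b) ≡ false
≢⇒≡ᵇ-false a b a≢b = ¬-not (λ t → a≢b (≡ᵇ⇒≡ a b (Equivalence.from T-≡ t)))

module NormalForm (n : ℕ) (adj : Adjacency n) (N' : ℕ)
                  (adj-sym : ∀ u v → adj u v ≡ adj v u) (adj-irrefl : ∀ v → adj v v ≡ false) where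

  N : ℕ
  N = suc N'

  Syllables : Set
  Syllables = List (Fin n × ℕ)

  -- a syllable (v , e) stands for v^e; exponent 0 syllables are never stored
  push : Fin n → ℕ → Syllables → Syllables
  push v zero T = T
  push v (suc r) T = (v , suc r) ∷ T

  -- left multiplication by v^a: v^a slides past syllables commuting with v and
  -- merges into the first syllable of v it meets, unless a non-commuting one comes first
  act : Fin n → ℕ → Syllables → Syllables
  act v a [] = push v (a % N) []
  act v a ((w , e) ∷ T) with w ≟ v
  ... | yes _ = push v ((e + a) % N) T
  ... | no _ with adj v w
  ...   | true = (w , e) ∷ act v a T
  ...   | false = push v (a % N) ((w , e) ∷ T)

  act-same : ∀ v a e T → act v a ((v , e) ∷ T) ≡ push v ((e + a) % N) T
  act-same v a e T with v ≟ v
  ... | yes _ = refl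
  ... | no v≢v = ⊥-elim (v≢v refl)

  act-commuting : ∀ v a w e T → w ≢ v → adj v w ≡ true → act v a ((w , e) ∷ T) ≡ (w , e) ∷ act v a T
  act-commuting v a w e T w≢v vw with w ≟ v
  ... | yes w≡v = ⊥-elim (w≢v w≡v)
  ... | no _ rewrite vw = refl

  act-blocked : ∀ v a w e T → w ≢ v → adj v w ≡ false → act v a ((w , e) ∷ T) ≡ push v (a % N) ((w , e) ∷ T)
  act-blocked v a w e T w≢v vw with w ≟ v
  ... | yes w≡v = ⊥-elim (w≢v w≡v)
  ... | no _ rewrite vw = refl

  data Relative (v w : Fin n) : Set where
    same : w ≡ v → Relative v w
    commuting : w ≢ v → adj v w ≡ true → Relative v w
    blocked : w ≢ v → adj v w ≡ false → Relative v w

  relative : ∀ v w → Relative v w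
  relative v w with w ≟ v
  ... | yes w≡v = same w≡v
  ... | no w≢v with adj v w in vw
  ...   | true = commuting w≢v vw
  ...   | false = blocked w≢v vw

  data Shuffle : Syllables → Syllables → Set where
    here : ∀ x y T → adj (proj₁ x) (proj₁ y) ≡ true → Shuffle (x ∷ y ∷ T) (y ∷ x ∷ T)
    there : ∀ z {R R'} → Shuffle R R' → Shuffle (z ∷ R) (z ∷ R')

  infix 4 _≈_
  _≈_ : Syllables → Syllables → Set
  _≈_ = EqClosure.EqClosure Shuffle

  ≡⇒≈ : ∀ {a b} → a ≡ b → a ≈ b
  ≡⇒≈ refl = ε

  shuffle⇒≈ : ∀ {a b} → Shuffle a b → a ≈ b
  shuffle⇒≈ s = fwd s ◅ ε

  ≈-sym : ∀ {a b} → a ≈ b → b ≈ a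
  ≈-sym = EqClosure.symmetric Shuffle

  ≈-∷ : ∀ z {a b} → a ≈ b → (z ∷ a) ≈ (z ∷ b)
  ≈-∷ z = gmap (z ∷_) there′
    where
    there′ : ∀ {a b} → SymClosure Shuffle a b → SymClosure Shuffle (z ∷ a) (z ∷ b)
    there′ (fwd s) = fwd (there z s)
    there′ (bwd s) = bwd (there z s)

  -- v^e and v^(e - N) are the two shortest words for the syllable
  sylCost : ℕ → ℕ
  sylCost e = e ⊓ (N ∸ e)

  cost : Syllables → ℕ
  cost [] = 0
  cost ((v , e) ∷ T) = sylCost e + cost T

  cost-shuffle : ∀ {R R'} → Shuffle R R' → cost R ≡ cost R'
  cost-shuffle (here (x , a) (y , b) T _) =
    trans (sym (+-assoc (sylCost a) (sylCost b) (cost T)))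
          (trans (cong (_+ cost T) (+-comm (sylCost a) (sylCost b))) (+-assoc (sylCost b) (sylCost a) (cost T)))
  cost-shuffle (there (z , c) s) = cong (sylCost c +_) (cost-shuffle s)

  cost-≈ : ∀ {R R'} → R ≈ R' → cost R ≡ cost R'
  cost-≈ ε = refl
  cost-≈ (fwd s ◅ r) = trans (cost-shuffle s) (cost-≈ r)
  cost-≈ (bwd s ◅ r) = trans (sym (cost-shuffle s)) (cost-≈ r)

  cost-push : ∀ v r T → cost (push v r T) ≡ sylCost r + cost T
  cost-push v zero T = refl
  cost-push v (suc r) T = refl

  adjacent-sym : ∀ {u v} → adj u v ≡ true → adj v u ≡ true
  adjacent-sym {u} {v} uv = trans (adj-sym v u) uv

  adjacent⇒≢ : ∀ {u v} → adj u v ≡ true → u ≢ v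
  adjacent⇒≢ {u} uv refl = true≢false uv (adj-irrefl u)

  push-≈ : ∀ v r {R R'} → R ≈ R' → push v r R ≈ push v r R'
  push-≈ v zero p = p
  push-≈ v (suc r) p = ≈-∷ (v , suc r) p

  push-past : ∀ v r w e T → adj v w ≡ true → push v r ((w , e) ∷ T) ≈ (w , e) ∷ push v r T
  push-past v zero w e T vw = ε
  push-past v (suc r) w e T vw = shuffle⇒≈ (here (v , suc r) (w , e) T vw)

  act-shuffle : ∀ v a {R R'} → Shuffle R R' → act v a R ≈ act v a R'
  act-shuffle v a (there (w , e) {R} {R'} s) with relative v w
  ... | same refl rewrite act-same v a e R | act-same v a e R' = push-≈ v ((e + a) % N) (shuffle⇒≈ s)
  ... | commuting ne vw rewrite act-commuting v a w e R ne vw | act-commuting v a w e R' ne vw =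
        ≈-∷ (w , e) (act-shuffle v a s)
  ... | blocked ne vw rewrite act-blocked v a w e R ne vw | act-blocked v a w e R' ne vw =
        push-≈ v (a % N) (shuffle⇒≈ (there (w , e) s))
  act-shuffle v a (here (w₁ , e₁) (w₂ , e₂) T a₁₂) with relative v w₁ | relative v w₂
  ... | same refl | same refl = ⊥-elim (adjacent⇒≢ a₁₂ refl)
  ... | same refl | commuting ne₂ v₂
        rewrite act-same v a e₁ ((w₂ , e₂) ∷ T) | act-commuting v a w₂ e₂ ((v , e₁) ∷ T) ne₂ v₂ | act-same v a e₁ T
        = push-past v ((e₁ + a) % N) w₂ e₂ T v₂
  ... | same refl | blocked ne₂ v₂ = ⊥-elim (true≢false a₁₂ v₂)
  ... | commuting ne₁ v₁ | same refl
        rewrite act-same v a e₂ ((w₁ , e₁) ∷ T) | act-commuting v a w₁ e₁ ((v , e₂) ∷ T) ne₁ v₁ | act-same v a e₂ T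
        = ≈-sym (push-past v ((e₂ + a) % N) w₁ e₁ T v₁)
  ... | commuting ne₁ v₁ | commuting ne₂ v₂
        rewrite act-commuting v a w₁ e₁ ((w₂ , e₂) ∷ T) ne₁ v₁ | act-commuting v a w₂ e₂ ((w₁ , e₁) ∷ T) ne₂ v₂
              | act-commuting v a w₂ e₂ T ne₂ v₂ | act-commuting v a w₁ e₁ T ne₁ v₁
        = shuffle⇒≈ (here (w₁ , e₁) (w₂ , e₂) (act v a T) a₁₂)
  ... | commuting ne₁ v₁ | blocked ne₂ v₂
        rewrite act-commuting v a w₁ e₁ ((w₂ , e₂) ∷ T) ne₁ v₁ | act-blocked v a w₂ e₂ ((w₁ , e₁) ∷ T) ne₂ v₂
              | act-blocked v a w₂ e₂ T ne₂ v₂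
        = ≈-sym (push-past v (a % N) w₁ e₁ ((w₂ , e₂) ∷ T) v₁)
          ◅◅ push-≈ v (a % N) (shuffle⇒≈ (here (w₁ , e₁) (w₂ , e₂) T a₁₂))
  ... | blocked ne₁ v₁ | same refl = ⊥-elim (true≢false (adjacent-sym a₁₂) v₁)
  ... | blocked ne₁ v₁ | commuting ne₂ v₂
        rewrite act-blocked v a w₁ e₁ ((w₂ , e₂) ∷ T) ne₁ v₁ | act-commuting v a w₂ e₂ ((w₁ , e₁) ∷ T) ne₂ v₂
              | act-blocked v a w₁ e₁ T ne₁ v₁
        = push-≈ v (a % N) (shuffle⇒≈ (here (w₁ , e₁) (w₂ , e₂) T a₁₂))
          ◅◅ push-past v (a % N) w₂ e₂ ((w₁ , e₁) ∷ T) v₂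
  ... | blocked ne₁ v₁ | blocked ne₂ v₂
        rewrite act-blocked v a w₁ e₁ ((w₂ , e₂) ∷ T) ne₁ v₁ | act-blocked v a w₂ e₂ ((w₁ , e₁) ∷ T) ne₂ v₂
        = push-≈ v (a % N) (shuffle⇒≈ (here (w₁ , e₁) (w₂ , e₂) T a₁₂))

  act-≈ : ∀ v a {R R'} → R ≈ R' → act v a R ≈ act v a R'
  act-≈ v a ε = ε
  act-≈ v a (fwd s ◅ r) = act-shuffle v a s ◅◅ act-≈ v a r
  act-≈ v a (bwd s ◅ r) = ≈-sym (act-shuffle v a s) ◅◅ act-≈ v a r

  -- Free v T: a syllable of v pushed in front of T can never merge into T
  data Free (v : Fin n) : Syllables → Set where
    []        : Free v []
    blocked   : ∀ {w e T} → w ≢ v → adj v w ≡ false → Free v ((w , e) ∷ T)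
    commuting : ∀ {w e T} → w ≢ v → adj v w ≡ true → Free v T → Free v ((w , e) ∷ T)

  data Reduced : Syllables → Set where
    []   : Reduced []
    cons : ∀ {v e T} → 0 < e → e < N → Free v T → Reduced T → Reduced ((v , e) ∷ T)

  act-free : ∀ v a {T} → Free v T → act v a T ≈ push v (a % N) T
  act-free v a [] = ε
  act-free v a (blocked {w} {e} {T} ne vw) rewrite act-blocked v a w e T ne vw = ε
  act-free v a (commuting {w} {e} {T} ne vw fr) rewrite act-commuting v a w e T ne vw =
    ≈-∷ (w , e) (act-free v a fr) ◅◅ ≈-sym (push-past v (a % N) w e T vw)

  free-push : ∀ x v r {T} → adj x v ≡ true → Free x T → Free x (push v r T)
  free-push x v zero xv fr = fr
  free-push x v (suc r) xv fr = commuting (λ v≡x → adjacent⇒≢ xv (sym v≡x)) xv fr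

  free-act : ∀ x v a {T} → adj x v ≡ true → Free x T → Free x (act v a T)
  free-act x v a xv [] = free-push x v (a % N) xv []
  free-act x v a xv (blocked {w} {e} {T} ne xw) with relative v w
  ... | same refl = ⊥-elim (true≢false xv xw)
  ... | commuting ne′ vw rewrite act-commuting v a w e T ne′ vw = blocked ne xw
  ... | blocked ne′ vw rewrite act-blocked v a w e T ne′ vw = free-push x v (a % N) xv (blocked ne xw)
  free-act x v a xv (commuting {w} {e} {T} ne xw fr) with relative v w
  ... | same refl rewrite act-same v a e T = free-push x v ((e + a) % N) xv fr
  ... | commuting ne′ vw rewrite act-commuting v a w e T ne′ vw = commuting ne xw (free-act x v a xv fr)
  ... | blocked ne′ vw rewrite act-blocked v a w e T ne′ vw = free-push x v (a % N) xv (commuting ne xw fr)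

  reduced-push : ∀ v r {T} → r < N → Free v T → Reduced T → Reduced (push v r T)
  reduced-push v zero r<N fr rd = rd
  reduced-push v (suc r) r<N fr rd = cons (s≤s z≤n) r<N fr rd

  reduced-act : ∀ v a {R} → Reduced R → Reduced (act v a R)
  reduced-act v a [] = reduced-push v (a % N) (m%n<n a N) [] []
  reduced-act v a (cons {w} {e} {T} pos lt fr rd) with relative v w
  ... | same refl rewrite act-same v a e T = reduced-push v ((e + a) % N) (m%n<n (e + a) N) fr rd
  ... | commuting ne vw rewrite act-commuting v a w e T ne vw =
        cons pos lt (free-act w v a (adjacent-sym vw) fr) (reduced-act v a rd)
  ... | blocked ne vw rewrite act-blocked v a w e T ne vw =
        reduced-push v (a % N) (m%n<n a N) (blocked ne vw) (cons pos lt fr rd)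

  %-+-assoc : ∀ x a b → ((x + b) % N + a) % N ≡ (x + (a + b)) % N
  %-+-assoc x a b =
    trans (%-distribˡ-+ ((x + b) % N) a N)
    (trans (cong (λ z → (z + a % N) % N) (m%n%n≡m%n (x + b) N))
    (trans (sym (%-distribˡ-+ (x + b) a N))
           (cong (_% N) (trans (+-assoc x b a) (cong (x +_) (+-comm b a))))))

  %-+-zero : ∀ e a → e < N → a % N ≡ 0 → (e + a) % N ≡ e
  %-+-zero e a e<N a≡0 =
    trans (%-distribˡ-+ e a N) (trans (cong (λ q → (e % N + q) % N) a≡0)
      (trans (cong (_% N) (+-identityʳ (e % N))) (trans (m%n%n≡m%n e N) (m<n⇒m%n≡m e<N))))

  act-trivial : ∀ v a {R} → Reduced R → a % N ≡ 0 → act v a R ≡ R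
  act-trivial v a [] a≡0 rewrite a≡0 = refl
  act-trivial v a (cons {w} {suc e} {T} pos lt fr rd) a≡0 with relative v w
  ... | same refl rewrite act-same v a (suc e) T | %-+-zero (suc e) a lt a≡0 = refl
  ... | commuting ne vw rewrite act-commuting v a w (suc e) T ne vw = cong ((w , suc e) ∷_) (act-trivial v a rd a≡0)
  ... | blocked ne vw rewrite act-blocked v a w (suc e) T ne vw | a≡0 = refl

  act-push-same : ∀ v a r {T} → Free v T → act v a (push v r T) ≈ push v ((r + a) % N) T
  act-push-same v a zero fr = act-free v a fr
  act-push-same v a (suc r) {T} fr rewrite act-same v a (suc r) T = ε

  act-act : ∀ v a b {R} → Reduced R → act v a (act v b R) ≈ act v (a + b) R
  act-act v a b [] = act-push-same v a (b % N) [] ◅◅ ≡⇒≈ (cong (λ z → push v z []) (%-+-assoc 0 a b))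
  act-act v a b (cons {w} {e} {T} pos lt fr rd) with relative v w
  ... | same refl rewrite act-same v b e T | act-same v (a + b) e T =
        act-push-same v a ((e + b) % N) fr ◅◅ ≡⇒≈ (cong (λ z → push v z T) (%-+-assoc e a b))
  ... | commuting ne vw
        rewrite act-commuting v b w e T ne vw | act-commuting v a w e (act v b T) ne vw
              | act-commuting v (a + b) w e T ne vw =
        ≈-∷ (w , e) (act-act v a b rd)
  ... | blocked ne vw rewrite act-blocked v b w e T ne vw | act-blocked v (a + b) w e T ne vw =
        act-push-same v a (b % N) (blocked ne vw) ◅◅ ≡⇒≈ (cong (λ z → push v z ((w , e) ∷ T)) (%-+-assoc 0 a b))

  act-push-commuting : ∀ u a v r {T} → adj u v ≡ true → act u a (push v r T) ≡ push v r (act u a T)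
  act-push-commuting u a v zero uv = refl
  act-push-commuting u a v (suc r) {T} uv = act-commuting u a v (suc r) T (λ v≡u → adjacent⇒≢ uv (sym v≡u)) uv

  push-push : ∀ u r₁ v r₂ {T} → adj u v ≡ true → push u r₁ (push v r₂ T) ≈ push v r₂ (push u r₁ T)
  push-push u zero v r₂ uv = ε
  push-push u (suc r₁) v zero uv = ε
  push-push u (suc r₁) v (suc r₂) {T} uv = shuffle⇒≈ (here (u , suc r₁) (v , suc r₂) T uv)

  act-commute : ∀ u a v b R → adj u v ≡ true → act u a (act v b R) ≈ act v b (act u a R)
  act-commute u a v b [] uv
    rewrite act-push-commuting u a v (b % N) {[]} uv | act-push-commuting v b u (a % N) {[]} (adjacent-sym uv) =
    ≈-sym (push-push u (a % N) v (b % N) uv)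
  act-commute u a v b ((w , e) ∷ T) uv with relative u w | relative v w
  ... | same refl | same refl = ⊥-elim (adjacent⇒≢ uv refl)
  ... | same refl | blocked _ vw = ⊥-elim (true≢false (adjacent-sym uv) vw)
  ... | same refl | commuting nev vw
        rewrite act-commuting v b w e T nev vw | act-same w a e (act v b T) | act-same w a e T
              | act-push-commuting v b w ((e + a) % N) {T} (adjacent-sym uv) = ε
  ... | blocked _ uw | same refl = ⊥-elim (true≢false uv uw)
  ... | commuting neu uw | same refl
        rewrite act-commuting u a w e T neu uw | act-same w b e (act u a T) | act-same w b e T
              | act-push-commuting u a w ((e + b) % N) {T} uv = ε
  ... | commuting neu uw | commuting nev vw
        rewrite act-commuting v b w e T nev vw | act-commuting u a w e (act v b T) neu uw
              | act-commuting u a w e T neu uw | act-commuting v b w e (act u a T) nev vw =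
        ≈-∷ (w , e) (act-commute u a v b T uv)
  ... | commuting neu uw | blocked nev vw
        rewrite act-blocked v b w e T nev vw | act-push-commuting u a v (b % N) {(w , e) ∷ T} uv
              | act-commuting u a w e T neu uw | act-blocked v b w e (act u a T) nev vw = ε
  ... | blocked neu uw | commuting nev vw
        rewrite act-blocked u a w e T neu uw | act-push-commuting v b u (a % N) {(w , e) ∷ T} (adjacent-sym uv)
              | act-commuting v b w e T nev vw | act-blocked u a w e (act v b T) neu uw = ε
  ... | blocked neu uw | blocked nev vw
        rewrite act-blocked v b w e T nev vw | act-blocked u a w e T neu uw
              | act-push-commuting u a v (b % N) {(w , e) ∷ T} uv
              | act-push-commuting v b u (a % N) {(w , e) ∷ T} (adjacent-sym uv)
              | act-blocked u a w e T neu uw | act-blocked v b w e T nev vw =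
        ≈-sym (push-push u (a % N) v (b % N) uv)

  actGen : Gen n → Syllables → Syllables
  actGen (v , true) = act v 1
  actGen (v , false) = act v N'

  actWord : Word n → Syllables → Syllables
  actWord [] R = R
  actWord (s ∷ w) R = actGen s (actWord w R)

  normalForm : Word n → Syllables
  normalForm w = actWord w []

  actWord-++ : ∀ a b R → actWord (a ++ b) R ≡ actWord a (actWord b R)
  actWord-++ [] b R = refl
  actWord-++ (s ∷ a) b R = cong (actGen s) (actWord-++ a b R)

  actGen-≈ : ∀ s {R R'} → R ≈ R' → actGen s R ≈ actGen s R'
  actGen-≈ (v , true) = act-≈ v 1
  actGen-≈ (v , false) = act-≈ v N'

  actWord-≈ : ∀ w {R R'} → R ≈ R' → actWord w R ≈ actWord w R'
  actWord-≈ [] p = p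
  actWord-≈ (s ∷ w) p = actGen-≈ s (actWord-≈ w p)

  reduced-actGen : ∀ s {R} → Reduced R → Reduced (actGen s R)
  reduced-actGen (v , true) = reduced-act v 1
  reduced-actGen (v , false) = reduced-act v N'

  reduced-actWord : ∀ w {R} → Reduced R → Reduced (actWord w R)
  reduced-actWord [] r = r
  reduced-actWord (s ∷ w) r = reduced-actGen s (reduced-actWord w r)

  reduced-normalForm : ∀ w → Reduced (normalForm w)
  reduced-normalForm w = reduced-actWord w []

  actWord-pow : ∀ v k {R} → Reduced R → actWord (pow v k) R ≈ act v k R
  actWord-pow v zero {R} r = ≡⇒≈ (sym (act-trivial v 0 r refl))
  actWord-pow v (suc k) r = act-≈ v 1 (actWord-pow v k r) ◅◅ act-act v 1 k r

  rule-invariant : ∀ {l r} → Rule n adj N l r → ∀ {R} → Reduced R → actWord l R ≈ actWord r R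
  rule-invariant (cancel v true) rd = act-act v 1 N' rd ◅◅ ≡⇒≈ (act-trivial v N rd (n%n≡0 N))
  rule-invariant (cancel v false) rd =
    act-act v N' 1 rd ◅◅ ≡⇒≈ (act-trivial v (N' + 1) rd (trans (cong (_% N) (+-comm N' 1)) (n%n≡0 N)))
  rule-invariant (power v) rd = actWord-pow v N rd ◅◅ ≡⇒≈ (act-trivial v N rd (n%n≡0 N))
  rule-invariant (commute u v uv) {R} rd = act-commute u 1 v 1 R uv

  step-invariant : ∀ {a b} → Step n adj N a b → normalForm a ≈ normalForm b
  step-invariant (step xs ys {l} {r} ρ) =
    ≡⇒≈ (trans (actWord-++ xs (l ++ ys) []) (cong (actWord xs) (actWord-++ l ys [])))
    ◅◅ actWord-≈ xs (rule-invariant ρ (reduced-normalForm ys))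
    ◅◅ ≡⇒≈ (sym (trans (actWord-++ xs (r ++ ys) []) (cong (actWord xs) (actWord-++ r ys []))))

  normalForm-invariant : ∀ {a b} → SameElement n adj N a b → normalForm a ≈ normalForm b
  normalForm-invariant ε = ε
  normalForm-invariant (fwd s ◅ r) = step-invariant s ◅◅ normalForm-invariant r
  normalForm-invariant (bwd s ◅ r) = ≈-sym (step-invariant s) ◅◅ normalForm-invariant r

  -- the word length of the element represented by a word
  norm : Word n → ℕ
  norm w = cost (normalForm w)

  norm-invariant : ∀ {a b} → SameElement n adj N a b → norm a ≡ norm b
  norm-invariant p = cost-≈ (normalForm-invariant p)

  -- multiplying by a generator changes a syllable exponent by ±1 mod N
  GrowsByOne : ℕ → Set
  GrowsByOne a = ∀ e → e < N → sylCost ((e + a) % N) ≤ suc (sylCost e)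

  growsByOne-1 : GrowsByOne 1
  growsByOne-1 e e<N with m≤n⇒m<n∨m≡n e<N
  ... | inj₂ e+1≡N rewrite +-comm e 1 | e+1≡N | n%n≡0 N {{_}} = z≤n
  ... | inj₁ e+1<N rewrite +-comm e 1 | m<n⇒m%n≡m e+1<N =
        ⊓-mono-≤ ≤-refl (m≤n⇒m≤1+n (∸-monoʳ-≤ N (n≤1+n e)))

  growsByOne-N' : GrowsByOne N'
  growsByOne-N' zero _ rewrite m<n⇒m%n≡m (≤-refl {N}) =
    ≤-trans (m⊓n≤n N' (N ∸ N')) (≤-reflexive (m+n∸n≡m 1 N'))
  growsByOne-N' (suc e) e<N =
    subst (λ z → sylCost z ≤ suc (sylCost (suc e))) (sym wraps) (⊓-mono-≤ (m≤n⇒m≤1+n (n≤1+n e)) (∸-suc N e))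
    where
    wraps : (suc e + N') % N ≡ e
    wraps = trans (cong (_% N) (sym (+-suc e N'))) (trans ([m+n]%n≡m%n e N) (m<n⇒m%n≡m (<⇒≤ e<N)))
    ∸-suc : ∀ m e → m ∸ e ≤ suc (m ∸ suc e)
    ∸-suc zero zero = z≤n
    ∸-suc zero (suc e) = z≤n
    ∸-suc (suc m) zero = ≤-refl
    ∸-suc (suc m) (suc e) = ∸-suc m e

  cost-act≤ : ∀ v a {R} → GrowsByOne a → Reduced R → cost (act v a R) ≤ suc (cost R)
  cost-act≤ v a grows [] =
    ≤-trans (≤-reflexive (trans (cost-push v (a % N) []) (+-identityʳ _))) (grows 0 (s≤s z≤n))
  cost-act≤ v a grows (cons {w} {e} {T} pos lt fr rd) with relative v w
  ... | same refl rewrite act-same v a e T | cost-push v ((e + a) % N) T = +-monoˡ-≤ (cost T) (grows e lt)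
  ... | commuting ne vw rewrite act-commuting v a w e T ne vw =
        ≤-trans (+-monoʳ-≤ (sylCost e) (cost-act≤ v a grows rd)) (≤-reflexive (+-suc (sylCost e) (cost T)))
  ... | blocked ne vw rewrite act-blocked v a w e T ne vw | cost-push v (a % N) ((w , e) ∷ T) =
        +-monoˡ-≤ (sylCost e + cost T) (grows 0 (s≤s z≤n))

  cost-actGen≤ : ∀ s {R} → Reduced R → cost (actGen s R) ≤ suc (cost R)
  cost-actGen≤ (v , true) = cost-act≤ v 1 growsByOne-1
  cost-actGen≤ (v , false) = cost-act≤ v N' growsByOne-N'

  norm≤length : ∀ w → norm w ≤ length w
  norm≤length [] = z≤n
  norm≤length (s ∷ w) = ≤-trans (cost-actGen≤ s (reduced-normalForm w)) (s≤s (norm≤length w))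

  free⊎cost≤ : ∀ u w a R → w ≢ u → adj u w ≡ false → Free u (act w a R) ⊎ cost (act w a R) ≤ cost R
  free⊎cost≤ u w a [] ne uw with a % N
  ... | zero = inj₁ []
  ... | suc r = inj₁ (blocked ne uw)
  free⊎cost≤ u w a ((x , e) ∷ T) ne uw with relative w x
  ... | same refl rewrite act-same x a e T with (e + a) % N
  ...   | zero = inj₂ (m≤n+m (cost T) (sylCost e))
  ...   | suc r = inj₁ (blocked ne uw)
  free⊎cost≤ u w a ((x , e) ∷ T) ne uw | commuting nx wx rewrite act-commuting w a x e T nx wx with relative u x
  ...   | same refl = ⊥-elim (true≢false wx (trans (adj-sym w x) uw))
  ...   | blocked nux ux = inj₁ (blocked nux ux)
  ...   | commuting nux ux with free⊎cost≤ u w a T ne uw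
  ...     | inj₁ fr = inj₁ (commuting nux ux fr)
  ...     | inj₂ le = inj₂ (+-monoʳ-≤ (sylCost e) le)
  free⊎cost≤ u w a ((x , e) ∷ T) ne uw | blocked nx wx rewrite act-blocked w a x e T nx wx with a % N
  ...   | zero = inj₂ ≤-refl
  ...   | suc r = inj₁ (blocked ne uw)

  cost-actWord-pow : ∀ v k {R} → Reduced R → Free v R → k < N → cost (actWord (pow v k) R) ≡ sylCost k + cost R
  cost-actWord-pow v k {R} rd fr k<N =
    trans (cost-≈ (actWord-pow v k rd ◅◅ act-free v k fr))
          (trans (cost-push v (k % N) R) (cong (λ z → sylCost z + cost R) (m<n⇒m%n≡m k<N)))

  free-actWord-pow : ∀ u v k {R} → adj u v ≡ true → Free u R → Free u (actWord (pow v k) R)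
  free-actWord-pow u v zero uv fr = fr
  free-actWord-pow u v (suc k) uv fr = free-act u v 1 uv (free-actWord-pow u v k uv fr)

open Count

Count-resp : ∀ {A : Set} {P Q : A → Set} {c} → Count P c → (∀ x → P x → Q x) → (∀ x → Q x → P x) → Count Q c
Count-resp C P⇒Q Q⇒P = record
  { enum = enum C ; inj = inj C ; sound = λ i → P⇒Q _ (sound C i) ; complete = λ w q → complete C w (Q⇒P w q) }

-- two enumerations of the same predicate give injections both ways
Count-unique : ∀ {A : Set} {P : A → Set} {a b} → Count P a → Count P b → a ≡ b
Count-unique C D = ≤-antisym (injective⇒≤ (reindex-injective C D)) (injective⇒≤ (reindex-injective D C))
  where
  reindex : ∀ {A : Set} {P : A → Set} {a b} → Count P a → Count P b → Fin a → Fin b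
  reindex C D i = proj₁ (complete D (enum C i) (sound C i))
  reindex-injective : ∀ {A : Set} {P : A → Set} {a b} (C : Count P a) (D : Count P b) →
                      ∀ {i j} → reindex C D i ≡ reindex C D j → i ≡ j
  reindex-injective C D {i} {j} eq = inj C i j
    (trans (sym (proj₂ (complete D (enum C i) (sound C i))))
           (trans (cong (enum D) eq) (proj₂ (complete D (enum C j) (sound C j)))))

Count-empty : ∀ {A : Set} {P : A → Set} → (∀ x → P x → ⊥) → Count P 0
Count-empty ¬P = record { enum = λ () ; inj = λ () ; sound = λ () ; complete = λ w p → ⊥-elim (¬P w p) }

Count-single : ∀ {A : Set} {P : A → Set} (a : A) → P a → (∀ x → P x → x ≡ a) → Count P 1
Count-single a pa unique = record
  { enum = λ _ → a ; inj = λ { Fin.zero Fin.zero _ → refl } ; sound = λ _ → pa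
  ; complete = λ w p → Fin.zero , sym (unique w p) }

Count-⊎ : ∀ {A : Set} {P Q : A → Set} {a b} → Count P a → Count Q b → (∀ x → P x → Q x → ⊥) →
          Count (λ x → P x ⊎ Q x) (a + b)
Count-⊎ {A} {P} {Q} {a} {b} C D disjoint = record { enum = e ; inj = e-inj ; sound = e-sound ; complete = e-complete }
  where
  e : Fin (a + b) → A
  e i = [ enum C , enum D ]′ (splitAt a i)
  e-sound : ∀ i → P (e i) ⊎ Q (e i)
  e-sound i with splitAt a i
  ... | inj₁ x = inj₁ (sound C x)
  ... | inj₂ y = inj₂ (sound D y)
  splitAt-injective : ∀ i j → splitAt a i ≡ splitAt a j → i ≡ j
  splitAt-injective i j eq = trans (sym (join-splitAt a b i)) (trans (cong (join a b) eq) (join-splitAt a b j))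
  e-inj : ∀ i j → e i ≡ e j → i ≡ j
  e-inj i j eq with splitAt a i in ei | splitAt a j in ej
  ... | inj₁ x | inj₁ y = splitAt-injective i j (trans ei (trans (cong inj₁ (inj C x y eq)) (sym ej)))
  ... | inj₂ x | inj₂ y = splitAt-injective i j (trans ei (trans (cong inj₂ (inj D x y eq)) (sym ej)))
  ... | inj₁ x | inj₂ y = ⊥-elim (disjoint (enum C x) (sound C x) (subst Q (sym eq) (sound D y)))
  ... | inj₂ x | inj₁ y = ⊥-elim (disjoint (enum C y) (sound C y) (subst Q eq (sound D x)))
  e-complete : ∀ w → P w ⊎ Q w → ∃ λ i → e i ≡ w
  e-complete w (inj₁ p) with complete C w p
  ... | x , ex = (x ↑ˡ b) , trans (cong [ enum C , enum D ]′ (splitAt-↑ˡ a x b)) ex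
  e-complete w (inj₂ q) with complete D w q
  ... | y , ey = (a ↑ʳ y) , trans (cong [ enum C , enum D ]′ (splitAt-↑ʳ a b y)) ey

Count-image : ∀ {A B : Set} {P : A → Set} {Q : B → Set} {c} → Count P c → (h : A → B) →
              (∀ x y → h x ≡ h y → x ≡ y) → (∀ x → P x → Q (h x)) →
              (∀ z → Q z → Σ A λ x → P x × h x ≡ z) → Count Q c
Count-image C h h-inj P⇒Q Q⇒P = record
  { enum = λ i → h (enum C i)
  ; inj = λ i j eq → inj C i j (h-inj _ _ eq)
  ; sound = λ i → P⇒Q _ (sound C i)
  ; complete = λ z q → let (x , p , hx) = Q⇒P z q ; (i , ei) = complete C x p in i , trans (cong h ei) hx }

Count-Σ : ∀ {A : Set} (k : ℕ) {Q : Fin k → A → Set} {c : Fin k → ℕ} →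
          (∀ i → Count (Q i) (c i)) → (∀ i j x → Q i x → Q j x → i ≡ j) →
          Count (λ x → Σ (Fin k) λ i → Q i x) (sumFin k c)
Count-Σ zero C disjoint = Count-empty (λ x → λ { (() , _) })
Count-Σ (suc k) {Q} C disjoint =
  Count-resp
    (Count-⊎ (C Fin.zero)
             (Count-Σ k {λ i → Q (Fin.suc i)} (λ i → C (Fin.suc i))
                      (λ i j x p q → Fin-suc-injective (disjoint (Fin.suc i) (Fin.suc j) x p q)))
             (λ x p → λ { (i , q) → 0≢suc (disjoint Fin.zero (Fin.suc i) x p q) }))
    (λ x → λ { (inj₁ p) → Fin.zero , p ; (inj₂ (i , q)) → Fin.suc i , q })
    (λ x → λ { (Fin.zero , p) → inj₁ p ; (Fin.suc i , q) → inj₂ (i , q) })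
  where
  0≢suc : ∀ {k} {i : Fin k} → Fin.zero ≡ Fin.suc i → ⊥
  0≢suc ()

sumFin-cong : ∀ k {f g : Fin k → ℕ} → (∀ i → f i ≡ g i) → sumFin k f ≡ sumFin k g
sumFin-cong zero eq = refl
sumFin-cong (suc k) eq = cong₂ _+_ (eq Fin.zero) (sumFin-cong k (λ i → eq (Fin.suc i)))

sumFin-zero : ∀ k → sumFin k (λ _ → 0) ≡ 0
sumFin-zero zero = refl
sumFin-zero (suc k) = sumFin-zero k

module WordCounting (n : ℕ) where

  countWords : (Word n → Bool) → ℕ → ℕ
  countWords B zero = if B [] then 1 else 0
  countWords B (suc m) =
    sumFin n (λ w → countWords (λ y → B ((w , true) ∷ y)) m + countWords (λ y → B ((w , false) ∷ y)) m)

  OfLength : (Word n → Bool) → ℕ → Word n → Set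
  OfLength B m x = length x ≡ m × T (B x)

  countWords-Count : ∀ B m → Count (OfLength B m) (countWords B m)
  countWords-Count B zero with B [] in eq
  ... | true = Count-single [] (refl , subst T (sym eq) tt) (λ { [] _ → refl })
  ... | false = Count-empty (λ { [] (_ , t) → subst T eq t })
  countWords-Count B (suc m) =
    Count-resp
      (Count-Σ n {λ w x → Extends (w , true) x ⊎ Extends (w , false) x}
         (λ w → Count-⊎ (count-Extends (w , true)) (count-Extends (w , false)) (λ { x (y , _ , refl) (y' , _ , ()) }))
         (λ { i j x (inj₁ (y , _ , refl)) (inj₁ (_ , _ , refl)) → refl
            ; i j x (inj₁ (y , _ , refl)) (inj₂ (_ , _ , ()))
            ; i j x (inj₂ (y , _ , refl)) (inj₁ (_ , _ , ()))
            ; i j x (inj₂ (y , _ , refl)) (inj₂ (_ , _ , refl)) → refl }))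
      (λ { x (w , inj₁ (y , (l , t) , refl)) → cong suc l , t
         ; x (w , inj₂ (y , (l , t) , refl)) → cong suc l , t })
      (λ { ((w , true) ∷ y) (l , t) → w , inj₁ (y , (suc-injective l , t) , refl)
         ; ((w , false) ∷ y) (l , t) → w , inj₂ (y , (suc-injective l , t) , refl) })
    where
    Extends : Gen n → Word n → Set
    Extends s x = Σ (Word n) λ y → OfLength (λ y → B (s ∷ y)) m y × (s ∷ y) ≡ x
    count-Extends : ∀ s → Count (Extends s) (countWords (λ y → B (s ∷ y)) m)
    count-Extends s = Count-image (countWords-Count (λ y → B (s ∷ y)) m) (s ∷_) (λ { x y refl → refl })
                        (λ y p → y , p , refl) (λ { z (y , p , refl) → y , p , refl })

  Count⇒≡countWords : ∀ {P : Word n → Set} (B : Word n → Bool) m {c} → Count (λ x → length x ≡ m × P x) c →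
                      (∀ x → P x → T (B x)) → (∀ x → T (B x) → P x) → c ≡ countWords B m
  Count⇒≡countWords B m C P⇒B B⇒P =
    Count-unique (Count-resp C (λ x (l , p) → l , P⇒B x p) (λ x (l , t) → l , B⇒P x t)) (countWords-Count B m)

  countWords-cong : ∀ {B B' : Word n → Bool} m → (∀ x → B x ≡ B' x) → countWords B m ≡ countWords B' m
  countWords-cong zero eq = cong (λ b → if b then 1 else 0) (eq [])
  countWords-cong (suc m) eq =
    sumFin-cong n (λ w → cong₂ _+_ (countWords-cong m (λ y → eq _)) (countWords-cong m (λ y → eq _)))

  countWords-none : ∀ {B : Word n → Bool} m → (∀ x → B x ≡ false) → countWords B m ≡ 0
  countWords-none zero none rewrite none [] = refl
  countWords-none (suc m) none =
    trans (sumFin-cong n (λ w → cong₂ _+_ (countWords-none m (λ y → none _)) (countWords-none m (λ y → none _))))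
          (sumFin-zero n)

  flipAt : Fin n → Gen n → Gen n
  flipAt w (v , b) with v ≟ w
  ... | yes _ = (v , not b)
  ... | no _ = (v , b)

  countWords-flip : ∀ w m (B : Word n → Bool) → countWords (λ x → B (map (flipAt w) x)) m ≡ countWords B m
  countWords-flip w zero B = refl
  countWords-flip w (suc m) B = sumFin-cong n first-letter
    where
    first-letter : ∀ v →
      countWords (λ y → B (flipAt w (v , true) ∷ map (flipAt w) y)) m
        + countWords (λ y → B (flipAt w (v , false) ∷ map (flipAt w) y)) m
      ≡ countWords (λ y → B ((v , true) ∷ y)) m + countWords (λ y → B ((v , false) ∷ y)) m
    first-letter v with v ≟ w
    ... | yes _ = trans (cong₂ _+_ (countWords-flip w m (λ y → B ((v , false) ∷ y)))
                                   (countWords-flip w m (λ y → B ((v , true) ∷ y))))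
                        (+-comm (countWords (λ y → B ((v , false) ∷ y)) m) _)
    ... | no _ = cong₂ _+_ (countWords-flip w m (λ y → B ((v , true) ∷ y)))
                           (countWords-flip w m (λ y → B ((v , false) ∷ y)))

module Geodesics (n : ℕ) (adj : Adjacency n) (N' : ℕ)
                 (adj-sym : ∀ u v → adj u v ≡ adj v u) (adj-irrefl : ∀ v → adj v v ≡ false) where

  open WordEquality n adj N' adj-sym public hiding (N)
  open NormalForm n adj N' adj-sym adj-irrefl public
  open WordCounting n public

  sylWord : Fin n × ℕ → Word n
  sylWord (v , e) with e ≤? (N ∸ e)
  ... | yes _ = pow v e
  ... | no _ = replicate (N ∸ e) (v , false)

  expand : Syllables → Word n
  expand [] = []
  expand (x ∷ R) = sylWord x ++ expand R

  length-sylWord : ∀ v e → length (sylWord (v , e)) ≡ sylCost e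
  length-sylWord v e with e ≤? (N ∸ e)
  ... | yes e≤ = trans (length-replicate e) (sym (m≤n⇒m⊓n≡m e≤))
  ... | no e≰ = trans (length-replicate (N ∸ e)) (sym (m≥n⇒m⊓n≡n (<⇒≤ (≰⇒> e≰))))

  length-expand : ∀ R → length (expand R) ≡ cost R
  length-expand [] = refl
  length-expand ((v , e) ∷ R) = trans (length-++ (sylWord (v , e))) (cong₂ _+_ (length-sylWord v e) (length-expand R))

  sylWord~pow : ∀ v e → e ≤ N → sylWord (v , e) ~ pow v e
  sylWord~pow v e e≤N with e ≤? (N ∸ e)
  ... | yes _ = ε
  ... | no _ = inverse-pow~pow v (N ∸ e) (m∸n≤m N e) ◅◅ ≡⇒~ (cong (pow v) (m∸[m∸n]≡n e≤N))

  expand-push~ : ∀ v x {T} → expand (push v (x % N) T) ~ pow v x ++ expand T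
  expand-push~ v x {T} with x % N in eq
  ... | zero = ~-++ʳ (expand T) (~-sym (pow~pow-mod v x ◅◅ ≡⇒~ (cong (pow v) eq)))
  ... | suc r = ~-++ʳ (expand T) (sylWord~pow v (suc r) (<⇒≤ (subst (_< N) eq (m%n<n x N)))
                                  ◅◅ ~-sym (pow~pow-mod v x ◅◅ ≡⇒~ (cong (pow v) eq)))

  commutesWith-sylWord : ∀ v w e → adj v w ≡ true → CommutesWith v (sylWord (w , e))
  commutesWith-sylWord v w e vw with e ≤? (N ∸ e)
  ... | yes _ = replicate⁺ e vw
  ... | no _ = replicate⁺ (N ∸ e) vw

  pow-commutes : ∀ v a X → CommutesWith v X → (pow v a ++ X) ~ (X ++ pow v a)
  pow-commutes v a X vX = word-commutes (pow v a) X (replicate⁺ a vX)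

  expand-act~ : ∀ v a {R} → Reduced R → expand (act v a R) ~ pow v a ++ expand R
  expand-act~ v a [] = expand-push~ v a
  expand-act~ v a (cons {w} {e} {T} pos lt fr rd) with relative v w
  ... | same refl rewrite act-same v a e T =
        expand-push~ v (e + a)
        ◅◅ ≡⇒~ (cong (_++ expand T) (trans (cong (pow v) (+-comm e a)) (pow-+ v a e)))
        ◅◅ ≡⇒~ (++-assoc (pow v a) (pow v e) (expand T))
        ◅◅ ~-++ˡ (pow v a) (~-++ʳ (expand T) (~-sym (sylWord~pow v e (<⇒≤ lt))))
  ... | commuting ne vw rewrite act-commuting v a w e T ne vw =
        ~-++ˡ (sylWord (w , e)) (expand-act~ v a rd)
        ◅◅ ≡⇒~ (sym (++-assoc (sylWord (w , e)) (pow v a) (expand T)))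
        ◅◅ ~-++ʳ (expand T) (~-sym (pow-commutes v a (sylWord (w , e)) (commutesWith-sylWord v w e vw)))
        ◅◅ ≡⇒~ (++-assoc (pow v a) (sylWord (w , e)) (expand T))
  ... | blocked ne vw rewrite act-blocked v a w e T ne vw = expand-push~ v a

  expand-normalForm~ : ∀ w → expand (normalForm w) ~ w
  expand-normalForm~ [] = ε
  expand-normalForm~ ((v , true) ∷ w) =
    expand-act~ v 1 (reduced-normalForm w) ◅◅ ~-++ˡ (gen⁺ v ∷ []) (expand-normalForm~ w)
  expand-normalForm~ ((v , false) ∷ w) =
    expand-act~ v N' (reduced-normalForm w)
    ◅◅ ~-++ʳ (expand (normalForm w)) (~-sym (inverse-pow~pow v 1 (s≤s z≤n)))
    ◅◅ ~-++ˡ (gen⁻ v ∷ []) (expand-normalForm~ w)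

  Geo : Word n → Set
  Geo = Geodesic n adj N

  -- expand ∘ normalForm is a representative of length norm w
  geodesic⇒norm≡length : ∀ w → Geo w → norm w ≡ length w
  geodesic⇒norm≡length w geo with m≤n⇒m<n∨m≡n (norm≤length w)
  ... | inj₂ eq = eq
  ... | inj₁ lt = ⊥-elim (geo (expand (normalForm w))
                             (subst (_< length w) (sym (length-expand (normalForm w))) lt) (expand-normalForm~ w))

  norm≡length⇒geodesic : ∀ w → norm w ≡ length w → Geo w
  norm≡length⇒geodesic w eq w' lt s =
    <-irrefl refl (≤-trans (s≤s (≤-trans (≤-reflexive (trans (sym eq) (sym (norm-invariant s)))) (norm≤length w'))) lt)

  isGeodesic : Word n → Bool
  isGeodesic w = norm w ≡ᵇ length w

  isGeodesic⇒norm≡length : ∀ w → isGeodesic w ≡ true → norm w ≡ length w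
  isGeodesic⇒norm≡length w eq = ≡ᵇ⇒≡ _ _ (Equivalence.from T-≡ eq)

  norm≡length⇒isGeodesic : ∀ w → norm w ≡ length w → isGeodesic w ≡ true
  norm≡length⇒isGeodesic w eq = Equivalence.to T-≡ (≡⇒≡ᵇ _ _ eq)

  isGeodesic⇒Geo : ∀ w → isGeodesic w ≡ true → Geo w
  isGeodesic⇒Geo w eq = norm≡length⇒geodesic w (isGeodesic⇒norm≡length w eq)

  Geo⇒isGeodesic : ∀ w → Geo w → isGeodesic w ≡ true
  Geo⇒isGeodesic w geo = norm≡length⇒isGeodesic w (geodesic⇒norm≡length w geo)

  isGeodesic-≡ : ∀ a b → (Geo a → Geo b) → (Geo b → Geo a) → isGeodesic a ≡ isGeodesic b
  isGeodesic-≡ a b a⇒b b⇒a with isGeodesic a in ea | isGeodesic b in eb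
  ... | true | true = refl
  ... | false | false = refl
  ... | true | false = sym (trans (sym eb) (Geo⇒isGeodesic b (a⇒b (isGeodesic⇒Geo a ea))))
  ... | false | true = trans (sym ea) (Geo⇒isGeodesic a (b⇒a (isGeodesic⇒Geo b eb)))

  geodesic-prefix : ∀ a b → Geo (a ++ b) → Geo a
  geodesic-prefix a b geo a' lt s =
    geo (a' ++ b) (subst₂ _<_ (sym (length-++ a')) (sym (length-++ a)) (+-monoˡ-< (length b) lt)) (~-++ʳ b s)

  geodesic-suffix : ∀ a b → Geo (a ++ b) → Geo b
  geodesic-suffix a b geo b' lt s =
    geo (a ++ b') (subst₂ _<_ (sym (length-++ a)) (sym (length-++ a)) (+-monoʳ-< (length a) lt)) (~-++ˡ a s)

  isGeodesic-suffix : ∀ a b → isGeodesic (a ++ b) ≡ true → isGeodesic b ≡ true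
  isGeodesic-suffix a b eq = Geo⇒isGeodesic b (geodesic-suffix a b (isGeodesic⇒Geo _ eq))

  isGeodesic-suffix-false : ∀ a b → isGeodesic b ≡ false → isGeodesic (a ++ b) ≡ false
  isGeodesic-suffix-false a b ¬b = ¬-not λ ab → true≢false (isGeodesic-suffix a b ab) ¬b

  isGeodesic-infix : ∀ a b c → isGeodesic b ≡ false → isGeodesic (a ++ b ++ c) ≡ false
  isGeodesic-infix a b c ¬b = ¬-not λ abc → true≢false
    (Geo⇒isGeodesic b (geodesic-prefix b c (geodesic-suffix a (b ++ c) (isGeodesic⇒Geo _ abc)))) ¬b

  flipAt-same : ∀ w b → flipAt w (w , b) ≡ (w , not b)
  flipAt-same w b with w ≟ w
  ... | yes _ = refl
  ... | no w≢w = ⊥-elim (w≢w refl)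

  flipAt-other : ∀ w u b → u ≢ w → flipAt w (u , b) ≡ (u , b)
  flipAt-other w u b u≢w with u ≟ w
  ... | yes u≡w = ⊥-elim (u≢w u≡w)
  ... | no _ = refl

  flipAt-involutive : ∀ w s → flipAt w (flipAt w s) ≡ s
  flipAt-involutive w (u , b) with u ≟ w
  ... | yes refl rewrite flipAt-same u (not b) = cong (u ,_) (not-involutive b)
  ... | no u≢w = flipAt-other w u b u≢w

  map-flipAt-involutive : ∀ w x → map (flipAt w) (map (flipAt w) x) ≡ x
  map-flipAt-involutive w [] = refl
  map-flipAt-involutive w (s ∷ x) = cong₂ _∷_ (flipAt-involutive w s) (map-flipAt-involutive w x)

  -- inverting one generator is an automorphism of NGP(Γ,N)
  flipAt-rule~ : ∀ w {l r} → Rule n adj N l r → map (flipAt w) l ~ map (flipAt w) r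
  flipAt-rule~ w (cancel v b) with v ≟ w
  ... | yes _ = cancel~ v (not b)
  ... | no _ = cancel~ v b
  flipAt-rule~ w (power v) rewrite map-replicate (flipAt w) N (v , true) with v ≟ w
  ... | yes _ = inverse-pow~pow v N ≤-refl ◅◅ ≡⇒~ (cong (pow v) (n∸n≡0 N))
  ... | no _ = pow-N~[] v
  flipAt-rule~ w (commute u v uv) with u ≟ w | v ≟ w
  ... | yes _ | yes _ = commute~ u v _ _ uv
  ... | yes _ | no _ = commute~ u v _ _ uv
  ... | no _ | yes _ = commute~ u v _ _ uv
  ... | no _ | no _ = commute~ u v _ _ uv

  flipAt-step~ : ∀ w {a b} → Step n adj N a b → map (flipAt w) a ~ map (flipAt w) b
  flipAt-step~ w (step xs ys {l} {r} ρ) =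
    ≡⇒~ (trans (map-++ (flipAt w) xs (l ++ ys)) (cong (map (flipAt w) xs ++_) (map-++ (flipAt w) l ys)))
    ◅◅ ~-wrap (map (flipAt w) xs) (map (flipAt w) ys) (flipAt-rule~ w ρ)
    ◅◅ ≡⇒~ (sym (trans (map-++ (flipAt w) xs (r ++ ys)) (cong (map (flipAt w) xs ++_) (map-++ (flipAt w) r ys))))

  flipAt-~ : ∀ w {a b} → a ~ b → map (flipAt w) a ~ map (flipAt w) b
  flipAt-~ w ε = ε
  flipAt-~ w (fwd s ◅ r) = flipAt-step~ w s ◅◅ flipAt-~ w r
  flipAt-~ w (bwd s ◅ r) = ~-sym (flipAt-step~ w s) ◅◅ flipAt-~ w r

  geodesic-flipAt : ∀ w x → Geo x → Geo (map (flipAt w) x)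
  geodesic-flipAt w x geo x' lt s =
    geo (map (flipAt w) x') (subst₂ _<_ (sym (length-map (flipAt w) x')) (length-map (flipAt w) x) lt)
        (flipAt-~ w s ◅◅ ≡⇒~ (map-flipAt-involutive w x))

  isGeodesic-flipAt : ∀ w x → isGeodesic (map (flipAt w) x) ≡ isGeodesic x
  isGeodesic-flipAt w x =
    isGeodesic-≡ _ _ (λ geo → subst Geo (map-flipAt-involutive w x) (geodesic-flipAt w _ geo)) (geodesic-flipAt w x)

  map-flipAt-pow : ∀ w u k → u ≢ w → map (flipAt w) (pow u k) ≡ pow u k
  map-flipAt-pow w u k u≢w = trans (map-replicate (flipAt w) k (u , true)) (cong (λ s → replicate k s) (flipAt-other w u true u≢w))

  -- the automorphism flipAt w fixes p and exchanges w and w⁻¹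
  countWords-gen⁻≡gen⁺ : ∀ w p m → map (flipAt w) p ≡ p →
    countWords (λ y → isGeodesic (gen⁻ w ∷ p ++ y)) m ≡ countWords (λ y → isGeodesic (gen⁺ w ∷ p ++ y)) m
  countWords-gen⁻≡gen⁺ w p m p-fixed =
    trans (sym (countWords-flip w m (λ y → isGeodesic (gen⁻ w ∷ p ++ y))))
          (countWords-cong m (λ y → trans (cong isGeodesic (sym (flip-word y))) (isGeodesic-flipAt w (gen⁺ w ∷ p ++ y))))
    where
    flip-word : ∀ y → map (flipAt w) (gen⁺ w ∷ p ++ y) ≡ gen⁻ w ∷ p ++ map (flipAt w) y
    flip-word y = cong₂ _∷_ (flipAt-same w true) (trans (map-++ (flipAt w) p y) (cong (_++ map (flipAt w) y) p-fixed))

  infix 4 _≃_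
  _≃_ : Word n → Word n → Set
  a ≃ b = (a ~ b) × (length a ≡ length b)

  isGeodesic-≃ : ∀ {a b} → a ≃ b → isGeodesic a ≡ isGeodesic b
  isGeodesic-≃ (s , l) = cong₂ _≡ᵇ_ (norm-invariant s) l

  ≃-++ˡ : ∀ p {a b} → a ≃ b → (p ++ a) ≃ (p ++ b)
  ≃-++ˡ p (s , l) = ~-++ˡ p s , trans (length-++ p) (trans (cong (length p +_) l) (sym (length-++ p)))

  ≃-++ʳ : ∀ q {a b} → a ≃ b → (a ++ q) ≃ (b ++ q)
  ≃-++ʳ q {a} {b} (s , l) = ~-++ʳ q s , trans (length-++ a) (trans (cong (_+ length q) l) (sym (length-++ b)))

  ≃-trans : ∀ {a b c} → a ≃ b → b ≃ c → a ≃ c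
  ≃-trans (s , l) (s' , l') = (s ◅◅ s') , trans l l'

  ≡⇒≃ : ∀ {a b} → a ≡ b → a ≃ b
  ≡⇒≃ refl = ε , refl

  ≃-swap : ∀ A X → All (λ s → CommutesWith (proj₁ s) X) A → (A ++ X) ≃ (X ++ A)
  ≃-swap A X AX =
    word-commutes A X AX , trans (length-++ A) (trans (+-comm (length A) (length X)) (sym (length-++ X)))

  -- K plays the role of ⌊N/2⌋: exponents 1..K are exactly the geodesic powers
  module Balanced (tri : TriangleFree n adj) (K : ℕ)
                  (2K≤N : K + K ≤ N) (N≤2K+1 : N ≤ suc (K + K)) (K+1<N : suc K < N) where

    sylCost-≤K : ∀ k → k ≤ K → sylCost k ≡ k
    sylCost-≤K k k≤K = m≤n⇒m⊓n≡m (subst (_≤ N ∸ k) (m+n∸n≡m k k) (∸-monoˡ-≤ k (≤-trans (+-mono-≤ k≤K k≤K) 2K≤N)))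

    ≤K⇒<N : ∀ k → k ≤ K → k < N
    ≤K⇒<N k k≤K = ≤-trans (s≤s k≤K) (<⇒≤ K+1<N)

    isGeodesic-pow-++-free : ∀ v k z → isGeodesic z ≡ true → Free v (normalForm z) → k ≤ K →
                             isGeodesic (pow v k ++ z) ≡ true
    isGeodesic-pow-++-free v k z geo fr k≤K = norm≡length⇒isGeodesic (pow v k ++ z)
      (trans (cong cost (actWord-++ (pow v k) z []))
      (trans (cost-actWord-pow v k (reduced-normalForm z) fr (≤K⇒<N k k≤K))
      (trans (cong₂ _+_ (trans (sylCost-≤K k k≤K) (sym (length-replicate k))) (isGeodesic⇒norm≡length z geo))
             (sym (length-++ (pow v k))))))

    free⊎cost≤-actGen : ∀ v s R → proj₁ s ≢ v → adj v (proj₁ s) ≡ false →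
                        Free v (actGen s R) ⊎ cost (actGen s R) ≤ cost R
    free⊎cost≤-actGen v (w , true) R = free⊎cost≤ v w 1 R
    free⊎cost≤-actGen v (w , false) R = free⊎cost≤ v w N' R

    free-normalForm-blocked : ∀ v s y → isGeodesic (s ∷ y) ≡ true → proj₁ s ≢ v → adj v (proj₁ s) ≡ false →
                              Free v (normalForm (s ∷ y))
    free-normalForm-blocked v s y geo ne vs with free⊎cost≤-actGen v s (normalForm y) ne vs
    ... | inj₁ fr = fr
    ... | inj₂ le = ⊥-elim (<-irrefl refl (≤-trans (s≤s (≤-trans le (norm≤length y)))
                                                   (≤-reflexive (sym (isGeodesic⇒norm≡length (s ∷ y) geo)))))

    isGeodesic-pow-blocked : ∀ v k s y → proj₁ s ≢ v → adj v (proj₁ s) ≡ false → k ≤ K →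
                             isGeodesic (pow v k ++ s ∷ y) ≡ isGeodesic (s ∷ y)
    isGeodesic-pow-blocked v k s y ne vs k≤K with isGeodesic (s ∷ y) in geo
    ... | true = isGeodesic-pow-++-free v k (s ∷ y) geo (free-normalForm-blocked v s y geo ne vs) k≤K
    ... | false = isGeodesic-suffix-false (pow v k) (s ∷ y) geo

    isGeodesic-pow-pow-blocked : ∀ u v k l s y → adj u v ≡ true →
      proj₁ s ≢ u → adj u (proj₁ s) ≡ false → proj₁ s ≢ v → adj v (proj₁ s) ≡ false → k ≤ K → l ≤ K →
      isGeodesic (pow u k ++ pow v l ++ s ∷ y) ≡ isGeodesic (s ∷ y)
    isGeodesic-pow-pow-blocked u v k l s y uv ≢u us ≢v vs k≤K l≤K with isGeodesic (s ∷ y) in geo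
    ... | true = isGeodesic-pow-++-free u k (pow v l ++ s ∷ y)
                   (isGeodesic-pow-++-free v l (s ∷ y) geo (free-normalForm-blocked v s y geo ≢v vs) l≤K)
                   (subst (Free u) (sym (actWord-++ (pow v l) (s ∷ y) []))
                          (free-actWord-pow u v l uv (free-normalForm-blocked u s y geo ≢u us)))
                   k≤K
    ... | false = subst (λ z → isGeodesic z ≡ false) (++-assoc (pow u k) (pow v l) (s ∷ y))
                        (isGeodesic-suffix-false (pow u k ++ pow v l) (s ∷ y) geo)

    isGeodesic-pow : ∀ v k → k ≤ K → isGeodesic (pow v k ++ []) ≡ true
    isGeodesic-pow v k k≤K = isGeodesic-pow-++-free v k [] refl [] k≤K

    isGeodesic-pow-pow : ∀ u v k l → adj u v ≡ true → k ≤ K → l ≤ K → isGeodesic (pow u k ++ pow v l ++ []) ≡ true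
    isGeodesic-pow-pow u v k l uv k≤K l≤K = isGeodesic-pow-++-free u k (pow v l ++ []) (isGeodesic-pow v l l≤K)
      (subst (Free u) (sym (actWord-++ (pow v l) [] [])) (free-actWord-pow u v l uv [])) k≤K

    -- v^(K+1) equals the shorter word v^(K+1-N)
    isGeodesic-pow-suc-K : ∀ v → isGeodesic (pow v (suc K)) ≡ false
    isGeodesic-pow-suc-K v = ≢⇒≡ᵇ-false _ _ (λ eq → <-irrefl refl
      (≤-trans (s≤s (≤-reflexive (trans (sym eq) (trans norm-pow (+-identityʳ _))))) shorter))
      where
      norm-pow : norm (pow v (suc K)) ≡ sylCost (suc K) + 0
      norm-pow = cost-actWord-pow v (suc K) [] [] K+1<N
      shorter : sylCost (suc K) < length (pow v (suc K))
      shorter = ≤-trans (s≤s (m⊓n≤n (suc K) (N ∸ suc K)))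
                  (≤-trans (s≤s (≤-trans (∸-monoˡ-≤ (suc K) N≤2K+1) (≤-reflexive (m+n∸n≡m K K))))
                           (≤-reflexive (sym (length-replicate (suc K)))))

    isGeodesic-gen⁺gen⁻ : ∀ v → isGeodesic (gen⁺ v ∷ gen⁻ v ∷ []) ≡ false
    isGeodesic-gen⁺gen⁻ v = ≢⇒≡ᵇ-false _ _ (λ eq → 0≢2 (trans (sym norm≡0) eq))
      where
      norm≡0 : norm (gen⁺ v ∷ gen⁻ v ∷ []) ≡ 0
      norm≡0 = cost-≈ (act-act v 1 N' [] ◅◅ ≡⇒≈ (act-trivial v N [] (n%n≡0 N)))
      0≢2 : 0 ≢ 2
      0≢2 ()

    pow-++-gen⁺ : ∀ v k y → pow v k ++ gen⁺ v ∷ y ≡ pow v (suc k) ++ y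
    pow-++-gen⁺ v k y =
      trans (sym (++-assoc (pow v k) (gen⁺ v ∷ []) y)) (cong (_++ y) (sym (replicate-snoc (gen⁺ v) k)))

    isGeodesic-pow-gen⁻ : ∀ p v k y → 1 ≤ k → isGeodesic (p ++ pow v k ++ gen⁻ v ∷ y) ≡ false
    isGeodesic-pow-gen⁻ p v (suc k) y _ =
      trans (cong (λ z → isGeodesic (p ++ z))
                  (trans (cong (_++ gen⁻ v ∷ y) (replicate-snoc (gen⁺ v) k))
                         (++-assoc (pow v k) (gen⁺ v ∷ []) (gen⁻ v ∷ y))))
      (trans (cong isGeodesic (sym (++-assoc p (pow v k) (gen⁺ v ∷ gen⁻ v ∷ y))))
             (isGeodesic-infix (p ++ pow v k) (gen⁺ v ∷ gen⁻ v ∷ []) y (isGeodesic-gen⁺gen⁻ v)))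

    triangle-free₁ : ∀ u v w → adj u v ≡ true → adj u w ≡ true → adj v w ≡ false
    triangle-free₁ u v w uv uw = ¬-not (λ vw → tri u v w uv vw uw)

    triangle-free₂ : ∀ u v w → adj u v ≡ true → adj v w ≡ true → adj u w ≡ false
    triangle-free₂ u v w uv vw = ¬-not (λ uw → tri u v w uv vw uw)

    pow-commutes≃ : ∀ v k s y → adj v (proj₁ s) ≡ true → (pow v k ++ s ∷ y) ≃ (s ∷ pow v k ++ y)
    pow-commutes≃ v k s y vs =
      ≃-trans (≡⇒≃ (sym (++-assoc (pow v k) (s ∷ []) y))) (≃-++ʳ y (≃-swap (pow v k) (s ∷ []) (replicate⁺ k (vs ∷ []))))

    pow-pow-gen⁺≃ : ∀ u v k l y → adj u v ≡ true → (pow u k ++ pow v l ++ gen⁺ u ∷ y) ≃ (pow u (suc k) ++ pow v l ++ y)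
    pow-pow-gen⁺≃ u v k l y uv =
      ≃-trans (≃-++ˡ (pow u k) (pow-commutes≃ v l (gen⁺ u) y (adjacent-sym uv))) (≡⇒≃ (pow-++-gen⁺ u k (pow v l ++ y)))

    isGeodesic-pow-pow-gen⁻ : ∀ u v k l y → adj u v ≡ true → 1 ≤ k → isGeodesic (pow u k ++ pow v l ++ gen⁻ u ∷ y) ≡ false
    isGeodesic-pow-pow-gen⁻ u v k l y uv 1≤k =
      trans (isGeodesic-≃ (≃-++ˡ (pow u k) (pow-commutes≃ v l (gen⁻ u) y (adjacent-sym uv))))
            (isGeodesic-pow-gen⁻ [] u k (pow v l ++ y) 1≤k)

    isGeodesic-pow-pow-commutesˡ : ∀ u v k l s y → adj u v ≡ true → adj u (proj₁ s) ≡ true → proj₁ s ≢ v → l ≤ K →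
                                   isGeodesic (pow u k ++ pow v l ++ s ∷ y) ≡ isGeodesic (s ∷ pow u k ++ y)
    isGeodesic-pow-pow-commutesˡ u v k l s y uv us ≢v l≤K =
      trans (isGeodesic-≃ (≃-trans (≡⇒≃ (sym (++-assoc (pow u k) (pow v l) (s ∷ y))))
                          (≃-trans (≃-++ʳ (s ∷ y) (≃-swap (pow u k) (pow v l) (replicate⁺ k (replicate⁺ l uv))))
                          (≃-trans (≡⇒≃ (++-assoc (pow v l) (pow u k) (s ∷ y)))
                                   (≃-++ˡ (pow v l) (pow-commutes≃ u k s y us))))))
            (isGeodesic-pow-blocked v l s (pow u k ++ y) ≢v (triangle-free₁ u v (proj₁ s) uv us) l≤K)

    isGeodesic-pow-pow-commutesʳ : ∀ u v k l s y → adj u v ≡ true → adj v (proj₁ s) ≡ true → proj₁ s ≢ u → k ≤ K →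
                                   isGeodesic (pow u k ++ pow v l ++ s ∷ y) ≡ isGeodesic (s ∷ pow v l ++ y)
    isGeodesic-pow-pow-commutesʳ u v k l s y uv vs ≢u k≤K =
      trans (isGeodesic-≃ (≃-++ˡ (pow u k) (pow-commutes≃ v l s y vs)))
            (isGeodesic-pow-blocked u k s (pow v l ++ y) ≢u (triangle-free₂ u v (proj₁ s) uv vs) k≤K)

double : ∀ x → x + x ≡ 2 * x
double x = cong (x +_) (sym (+-identityʳ x))

x+0+0≡x : ∀ x → x + 0 + 0 ≡ x
x+0+0≡x x = trans (+-identityʳ (x + 0)) (+-identityʳ x)

m+[m∸1]*m≡m*m : ∀ m → m + (m ∸ 1) * m ≡ m * m
m+[m∸1]*m≡m*m zero = refl
m+[m∸1]*m≡m*m (suc m) = square m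
  where
  square : ∀ m → suc m + m * suc m ≡ suc m * suc m
  square = solve-∀

when : Bool → ℕ → ℕ
when b x = if b then x else 0

sumFin-+ : ∀ k (f g : Fin k → ℕ) → sumFin k (λ i → f i + g i) ≡ sumFin k f + sumFin k g
sumFin-+ zero f g = refl
sumFin-+ (suc k) f g =
  trans (cong (f Fin.zero + g Fin.zero +_) (sumFin-+ k (λ i → f (Fin.suc i)) (λ i → g (Fin.suc i))))
        (+-interchange (f Fin.zero) (g Fin.zero) _ _)
  where
  +-interchange : ∀ a b c d → (a + b) + (c + d) ≡ (a + c) + (b + d)
  +-interchange = solve-∀

sumFin-+₅ : ∀ k (f₁ f₂ f₃ f₄ f₅ : Fin k → ℕ) →
  sumFin k (λ i → f₁ i + f₂ i + f₃ i + f₄ i + f₅ i)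
  ≡ sumFin k f₁ + sumFin k f₂ + sumFin k f₃ + sumFin k f₄ + sumFin k f₅
sumFin-+₅ k f₁ f₂ f₃ f₄ f₅ =
  trans (sumFin-+ k (λ i → f₁ i + f₂ i + f₃ i + f₄ i) f₅)
  (cong (_+ sumFin k f₅) (trans (sumFin-+ k (λ i → f₁ i + f₂ i + f₃ i) f₄)
  (cong (_+ sumFin k f₄) (trans (sumFin-+ k (λ i → f₁ i + f₂ i) f₃)
  (cong (_+ sumFin k f₃) (sumFin-+ k f₁ f₂))))))

sumFin-*ˡ : ∀ k c (f : Fin k → ℕ) → sumFin k (λ i → c * f i) ≡ c * sumFin k f
sumFin-*ˡ zero c f = sym (*-zeroʳ c)
sumFin-*ˡ (suc k) c f =
  trans (cong (c * f Fin.zero +_) (sumFin-*ˡ k c (λ i → f (Fin.suc i)))) (sym (*-distribˡ-+ c (f Fin.zero) _))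

sumFin-*ʳ : ∀ k c (f : Fin k → ℕ) → sumFin k (λ i → f i * c) ≡ sumFin k f * c
sumFin-*ʳ k c f = trans (sumFin-cong k (λ i → *-comm (f i) c)) (trans (sumFin-*ˡ k c f) (*-comm c _))

sumFin-swap : ∀ a b (f : Fin a → Fin b → ℕ) →
              sumFin a (λ i → sumFin b (λ j → f i j)) ≡ sumFin b (λ j → sumFin a (λ i → f i j))
sumFin-swap zero b f = sym (sumFin-zero b)
sumFin-swap (suc a) b f =
  trans (cong (sumFin b (f Fin.zero) +_) (sumFin-swap a b (λ i → f (Fin.suc i))))
        (sym (sumFin-+ b (f Fin.zero) (λ j → sumFin a (λ i → f (Fin.suc i) j))))

sumFin-const : ∀ k c → sumFin k (λ _ → c) ≡ k * c
sumFin-const zero c = refl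
sumFin-const (suc k) c = cong (c +_) (sumFin-const k c)

sumFin-when : ∀ k b (f : Fin k → ℕ) → sumFin k (λ i → when b (f i)) ≡ when b (sumFin k f)
sumFin-when k true f = refl
sumFin-when k false f = sumFin-zero k

when-* : ∀ b x → when b x ≡ when b 1 * x
when-* true x = sym (+-identityʳ x)
when-* false x = refl

when-*ˡ : ∀ b c x → when b (c * x) ≡ c * when b x
when-*ˡ true c x = refl
when-*ˡ false c x = sym (*-zeroʳ c)

when-+ : ∀ b x y → when b (x + y) ≡ when b x + when b y
when-+ true x y = refl
when-+ false x y = refl

when-when : ∀ a b x → when a (when b x) ≡ when b (when a x)
when-when true true x = refl
when-when true false x = refl
when-when false true x = refl
when-when false false x = refl

when-when-∧ : ∀ a b c x → when a (when (b ∧ c) x) ≡ when b (when (a ∧ c) x)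
when-when-∧ true true c x = refl
when-when-∧ true false c x = refl
when-when-∧ false true c x = refl
when-when-∧ false false c x = refl

when-when-* : ∀ a b y → when a (when b y) ≡ when a (when b 1) * y
when-when-* true b y = when-* b y
when-when-* false b y = refl

eqᵇ : ∀ {k} → Fin k → Fin k → Bool
eqᵇ Fin.zero Fin.zero = true
eqᵇ Fin.zero (Fin.suc j) = false
eqᵇ (Fin.suc i) Fin.zero = false
eqᵇ (Fin.suc i) (Fin.suc j) = eqᵇ i j

eqᵇ-refl : ∀ {k} (i : Fin k) → eqᵇ i i ≡ true
eqᵇ-refl Fin.zero = refl
eqᵇ-refl (Fin.suc i) = eqᵇ-refl i

eqᵇ-≢ : ∀ {k} (i j : Fin k) → i ≢ j → eqᵇ i j ≡ false
eqᵇ-≢ Fin.zero Fin.zero i≢j = ⊥-elim (i≢j refl)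
eqᵇ-≢ Fin.zero (Fin.suc j) i≢j = refl
eqᵇ-≢ (Fin.suc i) Fin.zero i≢j = refl
eqᵇ-≢ (Fin.suc i) (Fin.suc j) i≢j = eqᵇ-≢ i j (λ i≡j → i≢j (cong Fin.suc i≡j))

eqᵇ-sym : ∀ {k} (i j : Fin k) → eqᵇ i j ≡ eqᵇ j i
eqᵇ-sym Fin.zero Fin.zero = refl
eqᵇ-sym Fin.zero (Fin.suc j) = refl
eqᵇ-sym (Fin.suc i) Fin.zero = refl
eqᵇ-sym (Fin.suc i) (Fin.suc j) = eqᵇ-sym i j

sumFin-delta : ∀ k (v : Fin k) (g : Fin k → ℕ) → sumFin k (λ w → when (eqᵇ w v) (g w)) ≡ g v
sumFin-delta (suc k) Fin.zero g =
  trans (cong (g Fin.zero +_) (sumFin-zero k)) (+-identityʳ (g Fin.zero))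
sumFin-delta (suc k) (Fin.suc v) g = sumFin-delta k v (λ i → g (Fin.suc i))

module Recurrences (n : ℕ) (adj : Adjacency n) (N' : ℕ)
                   (adj-sym : ∀ u v → adj u v ≡ adj v u) (adj-irrefl : ∀ v → adj v v ≡ false)
                   (tri : TriangleFree n adj) (K : ℕ)
                   (2K≤N : K + K ≤ suc N') (N≤2K+1 : suc N' ≤ suc (K + K)) (K+1<N : suc K < suc N')
                   (L : ℕ) (regular : IsRegular n adj L) where

  open Geodesics n adj N' adj-sym adj-irrefl
  open Balanced tri K 2K≤N N≤2K+1 K+1<N

  Δ : Fin n → ℕ → ℕ → ℕ
  Δ v k m = countWords (λ x → isGeodesic (pow v k ++ x)) m

  Δ₂ : Fin n → Fin n → ℕ → ℕ → ℕ → ℕ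
  Δ₂ u v k l m = countWords (λ x → isGeodesic (pow u k ++ pow v l ++ x)) m

  ≤K-not-suc≤K : ∀ k → k ≤ K → (suc k ≤ᵇ K) ≡ false → k ≡ K
  ≤K-not-suc≤K k k≤K k+1≰K =
    ≤-antisym k≤K (≤-pred (≰⇒> (λ k+1≤K → true≢false (Equivalence.to T-≡ (≤⇒≤ᵇ k+1≤K)) k+1≰K)))

  -- past K the prefix v^(K+1) is no longer geodesic, matching the convention G_{K+1} = 0
  Δ-suc-when : ∀ v k m → k ≤ K → Δ v (suc k) m ≡ when (suc k ≤ᵇ K) (Δ v (suc k) m)
  Δ-suc-when v k m k≤K with suc k ≤ᵇ K in k+1≤K
  ... | true = refl
  ... | false rewrite ≤K-not-suc≤K k k≤K k+1≤K =
        countWords-none m (λ x → isGeodesic-infix [] (pow v (suc K)) x (isGeodesic-pow-suc-K v))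

  Δ₂-sucˡ-when : ∀ u v k l m → k ≤ K → Δ₂ u v (suc k) l m ≡ when (suc k ≤ᵇ K) (Δ₂ u v (suc k) l m)
  Δ₂-sucˡ-when u v k l m k≤K with suc k ≤ᵇ K in k+1≤K
  ... | true = refl
  ... | false rewrite ≤K-not-suc≤K k k≤K k+1≤K =
        countWords-none m (λ x → isGeodesic-infix [] (pow u (suc K)) (pow v l ++ x) (isGeodesic-pow-suc-K u))

  Δ₂-sucʳ-when : ∀ u v k l m → l ≤ K → Δ₂ u v k (suc l) m ≡ when (suc l ≤ᵇ K) (Δ₂ u v k (suc l) m)
  Δ₂-sucʳ-when u v k l m l≤K with suc l ≤ᵇ K in l+1≤K
  ... | true = refl
  ... | false rewrite ≤K-not-suc≤K l l≤K l+1≤K =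
        countWords-none m (λ x → isGeodesic-infix (pow u k) (pow v (suc K)) x (isGeodesic-pow-suc-K v))

  -- the three kinds of first letter w^{±1} after v^k: w = v, w adjacent to v, or neither
  Δ-first-letter : ∀ v k m → 1 ≤ k → k ≤ K → ∀ w →
    countWords (λ y → isGeodesic (pow v k ++ gen⁺ w ∷ y)) m + countWords (λ y → isGeodesic (pow v k ++ gen⁻ w ∷ y)) m
    ≡ when (eqᵇ w v) (when (suc k ≤ᵇ K) (Δ v (suc k) m)) + when (adj v w) (2 * Δ₂ w v 1 k m)
      + when (not (eqᵇ w v) ∧ not (adj v w)) (2 * Δ w 1 m)
  Δ-first-letter v k m 1≤k k≤K w with relative v w
  ... | same refl rewrite eqᵇ-refl v | adj-irrefl v =
        trans (cong₂ _+_ (trans (countWords-cong m (λ y → cong isGeodesic (pow-++-gen⁺ v k y))) (Δ-suc-when v k m k≤K))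
                         (countWords-none m (λ y → isGeodesic-pow-gen⁻ [] v k y 1≤k)))
              (sym (+-identityʳ (when (suc k ≤ᵇ K) (Δ v (suc k) m) + 0)))
  ... | commuting w≢v vw rewrite eqᵇ-≢ w v w≢v | vw =
        trans (cong₂ _+_ (countWords-cong m (λ y → isGeodesic-≃ (pow-commutes≃ v k (gen⁺ w) y vw)))
                         (trans (countWords-cong m (λ y → isGeodesic-≃ (pow-commutes≃ v k (gen⁻ w) y vw)))
                                (countWords-gen⁻≡gen⁺ w (pow v k) m (map-flipAt-pow w v k (≢-sym w≢v)))))
              (trans (double (Δ₂ w v 1 k m)) (sym (+-identityʳ (2 * Δ₂ w v 1 k m))))
  ... | blocked w≢v vw rewrite eqᵇ-≢ w v w≢v | vw =
        trans (cong₂ _+_ (countWords-cong m (λ y → isGeodesic-pow-blocked v k (gen⁺ w) y w≢v vw k≤K))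
                         (trans (countWords-cong m (λ y → isGeodesic-pow-blocked v k (gen⁻ w) y w≢v vw k≤K))
                                (countWords-gen⁻≡gen⁺ w [] m refl)))
              (double (Δ w 1 m))

  count-nonNeighbours : ∀ w → sumFin n (λ v → when (not (eqᵇ w v) ∧ not (adj v w)) 1) ≡ n ∸ L ∸ 1
  count-nonNeighbours w = sym (∸-cancel _ (trans (sym (trans (sumFin-const n 1) (*-identityʳ n)))
    (trans (sumFin-cong n split)
    (trans (sumFin-+ n _ _)
           (cong₂ _+_ (trans (sumFin-+ n _ _) (cong₂ _+_ (sumFin-delta n w (λ _ → 1)) (regular w))) refl)))))
    where
    ∸-cancel : ∀ c → n ≡ 1 + L + c → n ∸ L ∸ 1 ≡ c
    ∸-cancel c n≡ = trans (cong (λ z → z ∸ L ∸ 1) (trans n≡ (sym (+-suc L c)))) (cong (_∸ 1) (m+n∸m≡n L (suc c)))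
    split : ∀ v → 1 ≡ (when (eqᵇ v w) 1 + when (adj w v) 1) + when (not (eqᵇ w v) ∧ not (adj v w)) 1
    split v with w ≟ v
    ... | yes refl rewrite eqᵇ-refl w | adj-irrefl w = refl
    ... | no w≢v rewrite eqᵇ-≢ w v w≢v | eqᵇ-≢ v w (≢-sym w≢v) | adj-sym v w with adj w v
    ...   | true = refl
    ...   | false = refl

  Δ-suc : ∀ v k m → 1 ≤ k → k ≤ K →
    Δ v k (suc m) ≡ when (suc k ≤ᵇ K) (Δ v (suc k) m) + sumFin n (λ w → when (adj v w) (2 * Δ₂ w v 1 k m))
                    + sumFin n (λ w → when (not (eqᵇ w v) ∧ not (adj v w)) (2 * Δ w 1 m))
  Δ-suc v k m 1≤k k≤K =
    trans (sumFin-cong n (Δ-first-letter v k m 1≤k k≤K))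
    (trans (sumFin-+ n (λ w → a w + b w) c)
      (cong (_+ sumFin n c) (trans (sumFin-+ n a b) (cong (_+ sumFin n b) (sumFin-delta n v (λ _ → _))))))
    where
    a b c : Fin n → ℕ
    a w = when (eqᵇ w v) (when (suc k ≤ᵇ K) (Δ v (suc k) m))
    b w = when (adj v w) (2 * Δ₂ w v 1 k m)
    c w = when (not (eqᵇ w v) ∧ not (adj v w)) (2 * Δ w 1 m)

  ΣΔ-suc : ∀ k m → 1 ≤ k → k ≤ K →
    sumFin n (λ v → Δ v k (suc m)) ≡
      when (suc k ≤ᵇ K) (sumFin n (λ v → Δ v (suc k) m))
      + 2 * sumFin n (λ u → sumFin n (λ v → when (adj u v) (Δ₂ u v 1 k m)))
      + 2 * (n ∸ L ∸ 1) * sumFin n (λ v → Δ v 1 m)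
  ΣΔ-suc k m 1≤k k≤K =
    trans (sumFin-cong n (λ v → Δ-suc v k m 1≤k k≤K))
    (trans (sumFin-+ n (λ v → a v + b v) c)
           (cong₂ _+_ (trans (sumFin-+ n a b) (cong₂ _+_ (sumFin-when n _ (λ v → Δ v (suc k) m)) neighbours)) others))
    where
    a b c : Fin n → ℕ
    a v = when (suc k ≤ᵇ K) (Δ v (suc k) m)
    b v = sumFin n (λ w → when (adj v w) (2 * Δ₂ w v 1 k m))
    c v = sumFin n (λ w → when (not (eqᵇ w v) ∧ not (adj v w)) (2 * Δ w 1 m))
    neighbours : sumFin n b ≡ 2 * sumFin n (λ u → sumFin n (λ v → when (adj u v) (Δ₂ u v 1 k m)))
    neighbours =
      trans (sumFin-swap n n (λ v w → when (adj v w) (2 * Δ₂ w v 1 k m)))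
      (trans (sumFin-cong n (λ w →
               trans (sumFin-cong n (λ v → trans (cong (λ q → when q (2 * Δ₂ w v 1 k m)) (adj-sym v w))
                                                 (when-*ˡ (adj w v) 2 (Δ₂ w v 1 k m))))
                     (sumFin-*ˡ n 2 (λ v → when (adj w v) (Δ₂ w v 1 k m)))))
             (sumFin-*ˡ n 2 (λ u → sumFin n (λ v → when (adj u v) (Δ₂ u v 1 k m)))))
    others : sumFin n c ≡ 2 * (n ∸ L ∸ 1) * sumFin n (λ v → Δ v 1 m)
    others =
      trans (sumFin-swap n n (λ v w → when (not (eqᵇ w v) ∧ not (adj v w)) (2 * Δ w 1 m)))
      (trans (sumFin-cong n (λ w →
               trans (sumFin-cong n (λ v → when-* (not (eqᵇ w v) ∧ not (adj v w)) (2 * Δ w 1 m)))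
               (trans (sumFin-*ʳ n (2 * Δ w 1 m) (λ v → when (not (eqᵇ w v) ∧ not (adj v w)) 1))
                      (cong (_* (2 * Δ w 1 m)) (count-nonNeighbours w)))))
      (trans (sumFin-*ˡ n (n ∸ L ∸ 1) (λ w → 2 * Δ w 1 m))
      (trans (cong ((n ∸ L ∸ 1) *_) (sumFin-*ˡ n 2 (λ w → Δ w 1 m)))
      (trans (sym (*-assoc (n ∸ L ∸ 1) 2 _)) (cong (_* sumFin n (λ v → Δ v 1 m)) (*-comm (n ∸ L ∸ 1) 2))))))

  sumEdges : (Fin n → Fin n → ℕ) → ℕ
  sumEdges h = sumFin n (λ u → sumFin n (λ v → when (adj u v) (h u v)))

  sumEdges-+ : ∀ f g → sumEdges (λ u v → f u v + g u v) ≡ sumEdges f + sumEdges g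
  sumEdges-+ f g =
    trans (sumFin-cong n (λ u → trans (sumFin-cong n (λ v → when-+ (adj u v) (f u v) (g u v)))
                                      (sumFin-+ n (λ v → when (adj u v) (f u v)) (λ v → when (adj u v) (g u v)))))
          (sumFin-+ n (λ u → sumFin n (λ v → when (adj u v) (f u v))) (λ u → sumFin n (λ v → when (adj u v) (g u v))))

  sumEdges-+₅ : ∀ f₁ f₂ f₃ f₄ f₅ →
    sumEdges (λ u v → f₁ u v + f₂ u v + f₃ u v + f₄ u v + f₅ u v)
    ≡ sumEdges f₁ + sumEdges f₂ + sumEdges f₃ + sumEdges f₄ + sumEdges f₅
  sumEdges-+₅ f₁ f₂ f₃ f₄ f₅ =
    trans (sumEdges-+ (λ u v → f₁ u v + f₂ u v + f₃ u v + f₄ u v) f₅)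
    (cong (_+ sumEdges f₅) (trans (sumEdges-+ (λ u v → f₁ u v + f₂ u v + f₃ u v) f₄)
    (cong (_+ sumEdges f₄) (trans (sumEdges-+ (λ u v → f₁ u v + f₂ u v) f₃)
    (cong (_+ sumEdges f₃) (sumEdges-+ f₁ f₂))))))

  sumEdges-cong : ∀ h h' → (∀ u v → adj u v ≡ true → h u v ≡ h' u v) → sumEdges h ≡ sumEdges h'
  sumEdges-cong h h' eq = sumFin-cong n (λ u → sumFin-cong n (λ v → on-edge u v))
    where
    on-edge : ∀ u v → when (adj u v) (h u v) ≡ when (adj u v) (h' u v)
    on-edge u v with adj u v in uv
    ... | true = eq u v uv
    ... | false = refl

  sumEdges-when : ∀ b h → sumEdges (λ u v → when b (h u v)) ≡ when b (sumEdges h)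
  sumEdges-when b h =
    trans (sumFin-cong n (λ u → trans (sumFin-cong n (λ v → when-when (adj u v) b (h u v)))
                                      (sumFin-when n b (λ v → when (adj u v) (h u v)))))
          (sumFin-when n b (λ u → sumFin n (λ v → when (adj u v) (h u v))))

  sumEdges-*ˡ : ∀ c h → sumEdges (λ u v → c * h u v) ≡ c * sumEdges h
  sumEdges-*ˡ c h =
    trans (sumFin-cong n (λ u → trans (sumFin-cong n (λ v → when-*ˡ (adj u v) c (h u v)))
                                      (sumFin-*ˡ n c (λ v → when (adj u v) (h u v)))))
          (sumFin-*ˡ n c (λ u → sumFin n (λ v → when (adj u v) (h u v))))

  sumEdges-flip : ∀ h → sumEdges h ≡ sumEdges (λ u v → h v u)
  sumEdges-flip h =
    trans (sumFin-swap n n (λ u v → when (adj u v) (h u v)))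
          (sumFin-cong n (λ v → sumFin-cong n (λ u → cong (λ q → when q (h u v)) (adj-sym u v))))

  indegree : ∀ w → sumFin n (λ u → when (adj u w) 1) ≡ L
  indegree w = trans (sumFin-cong n (λ u → cong (λ b → when b 1) (adj-sym u w))) (regular w)

  count-otherNeighbours : ∀ a w → adj a w ≡ true → sumFin n (λ b → when (adj a b ∧ not (eqᵇ w b)) 1) ≡ L ∸ 1
  count-otherNeighbours a w aw = sym
    (trans (cong (_∸ 1) (sym (regular a)))
    (trans (cong (_∸ 1) (trans (sumFin-cong n split) (sumFin-+ n (λ b → when (eqᵇ b w) 1) others)))
    (trans (cong (λ z → (z + sumFin n others) ∸ 1) (sumFin-delta n w (λ _ → 1))) (m+n∸m≡n 1 (sumFin n others)))))
    where
    others : Fin n → ℕ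
    others b = when (adj a b ∧ not (eqᵇ w b)) 1
    split : ∀ b → when (adj a b) 1 ≡ when (eqᵇ b w) 1 + others b
    split b with w ≟ b
    ... | yes refl rewrite eqᵇ-refl w | aw = refl
    ... | no w≢b rewrite eqᵇ-≢ w b w≢b | eqᵇ-≢ b w (≢-sym w≢b) | ∧-identityʳ (adj a b) = refl

  sumFin-otherNeighbours : ∀ u w x →
    sumFin n (λ v → when (adj u v) (when (adj u w ∧ not (eqᵇ w v)) x)) ≡ when (adj u w) ((L ∸ 1) * x)
  sumFin-otherNeighbours u w x =
    trans (sumFin-cong n (λ v → when-when-∧ (adj u v) (adj u w) (not (eqᵇ w v)) x))
    (trans (sumFin-when n (adj u w) (λ v → when (adj u v ∧ not (eqᵇ w v)) x)) on-uw)
    where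
    on-uw : when (adj u w) (sumFin n (λ v → when (adj u v ∧ not (eqᵇ w v)) x)) ≡ when (adj u w) ((L ∸ 1) * x)
    on-uw with adj u w in uw
    ... | false = refl
    ... | true = trans (sumFin-cong n (λ v → when-* (adj u v ∧ not (eqᵇ w v)) x))
                       (trans (sumFin-*ʳ n x (λ v → when (adj u v ∧ not (eqᵇ w v)) 1)) (cong (_* x) (count-otherNeighbours u w uw)))

  -- a path w - a - b is counted once for each of the L - 1 choices of b
  sumEdges-paths : ∀ (X : Fin n → Fin n → ℕ) →
    sumEdges (λ a b → sumFin n (λ w → when (adj a w ∧ not (eqᵇ w b)) (X w a))) ≡ (L ∸ 1) * sumEdges X
  sumEdges-paths X =
    trans (sumFin-cong n (λ a →
      trans (sumFin-cong n (λ b → sym (sumFin-when n (adj a b) (λ w → when (adj a w ∧ not (eqᵇ w b)) (X w a)))))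
      (trans (sumFin-swap n n (λ b w → when (adj a b) (when (adj a w ∧ not (eqᵇ w b)) (X w a))))
             (sumFin-cong n (λ w → sumFin-otherNeighbours a w (X w a))))))
    (trans (sumFin-cong n (λ a → trans (sumFin-cong n (λ w → when-*ˡ (adj a w) (L ∸ 1) (X w a)))
                                       (sumFin-*ˡ n (L ∸ 1) (λ w → when (adj a w) (X w a)))))
    (trans (sumFin-*ˡ n (L ∸ 1) _) (cong ((L ∸ 1) *_) (sym (sumEdges-flip X)))))

  data Around (u v w : Fin n) : Set where
    atU     : w ≡ u → Around u v w
    atV     : w ≡ v → Around u v w
    nextToU : w ≢ u → w ≢ v → adj u w ≡ true → Around u v w
    nextToV : w ≢ u → w ≢ v → adj u w ≡ false → adj v w ≡ true → Around u v w
    far     : w ≢ u → w ≢ v → adj u w ≡ false → adj v w ≡ false → Around u v w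

  around : ∀ u v w → Around u v w
  around u v w with w ≟ u
  ... | yes w≡u = atU w≡u
  ... | no w≢u with w ≟ v
  ...   | yes w≡v = atV w≡v
  ...   | no w≢v with adj u w in uw
  ...     | true = nextToU w≢u w≢v uw
  ...     | false with adj v w in vw
  ...       | true = nextToV w≢u w≢v uw vw
  ...       | false = far w≢u w≢v uw vw

  farFrom : Fin n → Fin n → Fin n → Bool
  farFrom u v w = not (eqᵇ w u) ∧ (not (eqᵇ w v) ∧ (not (adj u w) ∧ not (adj v w)))

  edge-partition : ∀ u v w → when (adj u v) 1 ≡
    when (adj u v) (when (eqᵇ w u) 1) + when (adj u v) (when (eqᵇ w v) 1)
    + when (adj u v) (when (adj u w ∧ not (eqᵇ w v)) 1) + when (adj u v) (when (adj v w ∧ not (eqᵇ w u)) 1)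
    + when (adj u v) (when (farFrom u v w) 1)
  edge-partition u v w with adj u v in uv
  ... | false = refl
  ... | true with around u v w
  ...   | atU refl rewrite eqᵇ-refl w | eqᵇ-≢ w v (adjacent⇒≢ uv) | adj-irrefl w | adjacent-sym uv = refl
  ...   | atV refl rewrite eqᵇ-refl w | eqᵇ-≢ w u (≢-sym (adjacent⇒≢ uv)) | adj-irrefl w | uv = refl
  ...   | nextToU w≢u w≢v uw rewrite eqᵇ-≢ w u w≢u | eqᵇ-≢ w v w≢v | uw | triangle-free₁ u v w uv uw = refl
  ...   | nextToV w≢u w≢v uw vw rewrite eqᵇ-≢ w u w≢u | eqᵇ-≢ w v w≢v | uw | vw = refl
  ...   | far w≢u w≢v uw vw rewrite eqᵇ-≢ w u w≢u | eqᵇ-≢ w v w≢v | uw | vw = refl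

  -- nL ordered edges, of which 2L + 2(L-1)L are near w
  count-farFrom : ∀ w → sumEdges (λ u v → when (farFrom u v w) 1) ≡ L * (n ∸ 2 * L)
  count-farFrom w = remainder _ (trans (sym edges)
    (trans (sumFin-cong n (λ u → sumFin-cong n (λ v → trans (edge-partition u v w) (sym (when-+₅ (adj u v) _ _ _ _ _)))))
    (trans (sumEdges-+₅ f₁ f₂ f₃ f₄ f₅) (cong (_+ sumEdges f₅) (cong₂ _+_ (cong₂ _+_ (cong₂ _+_ atU-count atV-count) nextToU-count) nextToV-count)))))
    where
    when-+₅ : ∀ b a₁ a₂ a₃ a₄ a₅ → when b (a₁ + a₂ + a₃ + a₄ + a₅) ≡ when b a₁ + when b a₂ + when b a₃ + when b a₄ + when b a₅
    when-+₅ true a₁ a₂ a₃ a₄ a₅ = refl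
    when-+₅ false a₁ a₂ a₃ a₄ a₅ = refl
    edges : sumFin n (λ u → sumFin n (λ v → when (adj u v) 1)) ≡ n * L
    edges = trans (sumFin-cong n regular) (sumFin-const n L)
    remainder : ∀ r → n * L ≡ L + L + (L ∸ 1) * L + (L ∸ 1) * L + r → r ≡ L * (n ∸ 2 * L)
    remainder r nL≡ =
      trans (sym (m+n∸m≡n (2 * (L * L)) r))
      (trans (cong (_∸ (2 * (L * L))) (sym (trans nL≡ (trans (regroup L ((L ∸ 1) * L) r) (cong (λ z → 2 * z + r) (m+[m∸1]*m≡m*m L))))))
      (trans (cong (n * L ∸_) (sym (*-assoc 2 L L))) (trans (sym (*-distribʳ-∸ L n (2 * L))) (*-comm (n ∸ 2 * L) L))))
      where
      regroup : ∀ a b r → a + a + b + b + r ≡ 2 * (a + b) + r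
      regroup = solve-∀
    f₁ f₂ f₃ f₄ f₅ : Fin n → Fin n → ℕ
    f₁ u v = when (eqᵇ w u) 1
    f₂ u v = when (eqᵇ w v) 1
    f₃ u v = when (adj u w ∧ not (eqᵇ w v)) 1
    f₄ u v = when (adj v w ∧ not (eqᵇ w u)) 1
    f₅ u v = when (farFrom u v w) 1
    atU-count : sumEdges f₁ ≡ L
    atU-count =
      trans (sumFin-cong n (λ u → trans (sumFin-cong n (λ v → when-when (adj u v) (eqᵇ w u) 1))
                                        (trans (sumFin-when n (eqᵇ w u) (λ v → when (adj u v) 1)) (cong₂ when (eqᵇ-sym w u) (regular u)))))
            (sumFin-delta n w (λ _ → L))
    atV-count : sumEdges f₂ ≡ L
    atV-count = trans (sumEdges-flip f₂) atU-count
    nextToU-count : sumEdges f₃ ≡ (L ∸ 1) * L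
    nextToU-count =
      trans (sumFin-cong n (λ u → trans (sumFin-otherNeighbours u w 1) (when-*ˡ (adj u w) (L ∸ 1) 1)))
            (trans (sumFin-*ˡ n (L ∸ 1) (λ u → when (adj u w) 1)) (cong ((L ∸ 1) *_) (indegree w)))
    nextToV-count : sumEdges f₄ ≡ (L ∸ 1) * L
    nextToV-count = trans (sumEdges-flip f₄) nextToU-count

  sumEdges-farFrom : ∀ (Y : Fin n → ℕ) →
    sumEdges (λ u v → sumFin n (λ w → when (farFrom u v w) (Y w))) ≡ L * (n ∸ 2 * L) * sumFin n Y
  sumEdges-farFrom Y =
    trans (sumFin-cong n (λ u → trans (sumFin-cong n (λ v → sym (sumFin-when n (adj u v) (λ w → when (farFrom u v w) (Y w)))))
                                      (sumFin-swap n n (λ v w → when (adj u v) (when (farFrom u v w) (Y w))))))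
    (trans (sumFin-swap n n (λ u w → sumFin n (λ v → when (adj u v) (when (farFrom u v w) (Y w)))))
    (trans (sumFin-cong n (λ w →
             trans (sumFin-cong n (λ u → trans (sumFin-cong n (λ v → when-when-* (adj u v) (farFrom u v w) (Y w)))
                                                (sumFin-*ʳ n (Y w) (λ v → when (adj u v) (when (farFrom u v w) 1)))))
             (trans (sumFin-*ʳ n (Y w) (λ u → sumFin n (λ v → when (adj u v) (when (farFrom u v w) 1))))
                    (cong (_* Y w) (count-farFrom w)))))
    (sumFin-*ˡ n (L * (n ∸ 2 * L)) Y)))

  Δ₂-first-letter : ∀ u v k l m → adj u v ≡ true → 1 ≤ k → k ≤ K → 1 ≤ l → l ≤ K → ∀ w →
    countWords (λ y → isGeodesic (pow u k ++ pow v l ++ gen⁺ w ∷ y)) m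
      + countWords (λ y → isGeodesic (pow u k ++ pow v l ++ gen⁻ w ∷ y)) m
    ≡ when (eqᵇ w u) (when (suc k ≤ᵇ K) (Δ₂ u v (suc k) l m)) + when (eqᵇ w v) (when (suc l ≤ᵇ K) (Δ₂ u v k (suc l) m))
      + when (adj u w ∧ not (eqᵇ w v)) (2 * Δ₂ w u 1 k m) + when (adj v w ∧ not (eqᵇ w u)) (2 * Δ₂ w v 1 l m)
      + when (farFrom u v w) (2 * Δ w 1 m)
  Δ₂-first-letter u v k l m uv 1≤k k≤K 1≤l l≤K w with around u v w
  ... | atU refl rewrite eqᵇ-refl w | eqᵇ-≢ w v (adjacent⇒≢ uv) | adj-irrefl w | adjacent-sym uv =
        trans (cong₂ _+_ (trans (countWords-cong m (λ y → isGeodesic-≃ (pow-pow-gen⁺≃ w v k l y uv))) (Δ₂-sucˡ-when w v k l m k≤K))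
                         (countWords-none m (λ y → isGeodesic-pow-pow-gen⁻ w v k l y uv 1≤k)))
              (sym (trans (x+0+0≡x _) (+-identityʳ _)))
  ... | atV refl rewrite eqᵇ-refl w | eqᵇ-≢ w u (≢-sym (adjacent⇒≢ uv)) | adj-irrefl w | uv =
        trans (cong₂ _+_ (trans (countWords-cong m (λ y → cong isGeodesic (cong (pow u k ++_) (pow-++-gen⁺ w l y))))
                                (Δ₂-sucʳ-when u w k l m l≤K))
                         (countWords-none m (λ y → isGeodesic-pow-gen⁻ (pow u k) w l y 1≤l)))
              (sym (x+0+0≡x (when (suc l ≤ᵇ K) (Δ₂ u w k (suc l) m) + 0)))
  ... | nextToU w≢u w≢v uw rewrite eqᵇ-≢ w u w≢u | eqᵇ-≢ w v w≢v | uw | triangle-free₁ u v w uv uw =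
        trans (cong₂ _+_ (countWords-cong m (λ y → isGeodesic-pow-pow-commutesˡ u v k l (gen⁺ w) y uv uw w≢v l≤K))
                         (trans (countWords-cong m (λ y → isGeodesic-pow-pow-commutesˡ u v k l (gen⁻ w) y uv uw w≢v l≤K))
                                (countWords-gen⁻≡gen⁺ w (pow u k) m (map-flipAt-pow w u k (≢-sym w≢u)))))
              (trans (double (Δ₂ w u 1 k m)) (sym (x+0+0≡x (2 * Δ₂ w u 1 k m))))
  ... | nextToV w≢u w≢v uw vw rewrite eqᵇ-≢ w u w≢u | eqᵇ-≢ w v w≢v | uw | vw =
        trans (cong₂ _+_ (countWords-cong m (λ y → isGeodesic-pow-pow-commutesʳ u v k l (gen⁺ w) y uv vw w≢u k≤K))
                         (trans (countWords-cong m (λ y → isGeodesic-pow-pow-commutesʳ u v k l (gen⁻ w) y uv vw w≢u k≤K))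
                                (countWords-gen⁻≡gen⁺ w (pow v l) m (map-flipAt-pow w v l (≢-sym w≢v)))))
              (trans (double (Δ₂ w v 1 l m)) (sym (+-identityʳ (2 * Δ₂ w v 1 l m))))
  ... | far w≢u w≢v uw vw rewrite eqᵇ-≢ w u w≢u | eqᵇ-≢ w v w≢v | uw | vw =
        trans (cong₂ _+_ (countWords-cong m (λ y → isGeodesic-pow-pow-blocked u v k l (gen⁺ w) y uv w≢u uw w≢v vw k≤K l≤K))
                         (trans (countWords-cong m (λ y → isGeodesic-pow-pow-blocked u v k l (gen⁻ w) y uv w≢u uw w≢v vw k≤K l≤K))
                                (countWords-gen⁻≡gen⁺ w [] m refl)))
              (double (Δ w 1 m))

  ΣΔ₂-suc : ∀ k l m → 1 ≤ k → k ≤ K → 1 ≤ l → l ≤ K →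
    sumEdges (λ u v → Δ₂ u v k l (suc m)) ≡
      when (suc k ≤ᵇ K) (sumEdges (λ u v → Δ₂ u v (suc k) l m)) + when (suc l ≤ᵇ K) (sumEdges (λ u v → Δ₂ u v k (suc l) m))
      + 2 * (L ∸ 1) * (sumEdges (λ u v → Δ₂ u v 1 k m) + sumEdges (λ u v → Δ₂ u v 1 l m))
      + 2 * L * (n ∸ 2 * L) * sumFin n (λ v → Δ v 1 m)
  ΣΔ₂-suc k l m 1≤k k≤K 1≤l l≤K = begin
    sumEdges (λ u v → Δ₂ u v k l (suc m))
      ≡⟨ sumEdges-cong _ _ (λ u v uv → trans (sumFin-cong n (Δ₂-first-letter u v k l m uv 1≤k k≤K 1≤l l≤K)) (split u v)) ⟩
    sumEdges (λ u v → g₁ u v + g₂ u v + S₃ u v + S₄ u v + S₅ u v)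
      ≡⟨ sumEdges-+₅ g₁ g₂ S₃ S₄ S₅ ⟩
    sumEdges g₁ + sumEdges g₂ + sumEdges S₃ + sumEdges S₄ + sumEdges S₅
      ≡⟨ cong₂ _+_ (cong₂ _+_ (cong₂ _+_ (cong₂ _+_ (sumEdges-when (suc k ≤ᵇ K) (λ u v → Δ₂ u v (suc k) l m))
                                                    (sumEdges-when (suc l ≤ᵇ K) (λ u v → Δ₂ u v k (suc l) m)))
                                         S₃-sum) S₄-sum) S₅-sum ⟩
    G₁ + G₂ + (L ∸ 1) * (2 * D₁) + (L ∸ 1) * (2 * D₂) + L * (n ∸ 2 * L) * (2 * D)
      ≡⟨ regroup G₁ G₂ (L ∸ 1) D₁ D₂ L (n ∸ 2 * L) D ⟩
    G₁ + G₂ + 2 * (L ∸ 1) * (D₁ + D₂) + 2 * L * (n ∸ 2 * L) * D ∎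
    where
    open ≡-Reasoning
    regroup : ∀ a b c d e f g h → a + b + c * (2 * d) + c * (2 * e) + f * g * (2 * h) ≡ a + b + 2 * c * (d + e) + 2 * f * g * h
    regroup = solve-∀
    G₁ G₂ D₁ D₂ D : ℕ
    G₁ = when (suc k ≤ᵇ K) (sumEdges (λ u v → Δ₂ u v (suc k) l m))
    G₂ = when (suc l ≤ᵇ K) (sumEdges (λ u v → Δ₂ u v k (suc l) m))
    D₁ = sumEdges (λ u v → Δ₂ u v 1 k m)
    D₂ = sumEdges (λ u v → Δ₂ u v 1 l m)
    D = sumFin n (λ v → Δ v 1 m)
    g₁ g₂ S₃ S₄ S₅ : Fin n → Fin n → ℕ
    g₁ u v = when (suc k ≤ᵇ K) (Δ₂ u v (suc k) l m)
    g₂ u v = when (suc l ≤ᵇ K) (Δ₂ u v k (suc l) m)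
    S₃ u v = sumFin n (λ w → when (adj u w ∧ not (eqᵇ w v)) (2 * Δ₂ w u 1 k m))
    S₄ u v = sumFin n (λ w → when (adj v w ∧ not (eqᵇ w u)) (2 * Δ₂ w v 1 l m))
    S₅ u v = sumFin n (λ w → when (farFrom u v w) (2 * Δ w 1 m))
    split : ∀ u v → sumFin n (λ w →
        when (eqᵇ w u) (g₁ u v) + when (eqᵇ w v) (g₂ u v)
        + when (adj u w ∧ not (eqᵇ w v)) (2 * Δ₂ w u 1 k m) + when (adj v w ∧ not (eqᵇ w u)) (2 * Δ₂ w v 1 l m)
        + when (farFrom u v w) (2 * Δ w 1 m))
      ≡ g₁ u v + g₂ u v + S₃ u v + S₄ u v + S₅ u v
    split u v = trans (sumFin-+₅ n _ _ _ _ _)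
      (cong (λ z → z + S₃ u v + S₄ u v + S₅ u v) (cong₂ _+_ (sumFin-delta n u (λ _ → g₁ u v)) (sumFin-delta n v (λ _ → g₂ u v))))
    S₃-sum : sumEdges S₃ ≡ (L ∸ 1) * (2 * D₁)
    S₃-sum = trans (sumEdges-paths (λ w a → 2 * Δ₂ w a 1 k m)) (cong ((L ∸ 1) *_) (sumEdges-*ˡ 2 (λ u v → Δ₂ u v 1 k m)))
    S₄-sum : sumEdges S₄ ≡ (L ∸ 1) * (2 * D₂)
    S₄-sum = trans (sumEdges-flip S₄)
             (trans (sumEdges-paths (λ w a → 2 * Δ₂ w a 1 l m)) (cong ((L ∸ 1) *_) (sumEdges-*ˡ 2 (λ u v → Δ₂ u v 1 l m))))
    S₅-sum : sumEdges S₅ ≡ L * (n ∸ 2 * L) * (2 * D)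
    S₅-sum = trans (sumEdges-farFrom (λ w → 2 * Δ w 1 m)) (cong (L * (n ∸ 2 * L) *_) (sumFin-*ˡ n 2 (λ v → Δ v 1 m)))

⌊n/2⌋+⌊n/2⌋≤n : ∀ m → ⌊ m /2⌋ + ⌊ m /2⌋ ≤ m
⌊n/2⌋+⌊n/2⌋≤n m = ≤-trans (+-monoʳ-≤ ⌊ m /2⌋ (⌊n/2⌋≤⌈n/2⌉ m)) (≤-reflexive (⌊n/2⌋+⌈n/2⌉≡n m))

n≤1+⌊n/2⌋+⌊n/2⌋ : ∀ m → m ≤ suc (⌊ m /2⌋ + ⌊ m /2⌋)
n≤1+⌊n/2⌋+⌊n/2⌋ zero = z≤n
n≤1+⌊n/2⌋+⌊n/2⌋ (suc zero) = s≤s z≤n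
n≤1+⌊n/2⌋+⌊n/2⌋ (suc (suc m)) =
  s≤s (subst (suc m ≤_) (cong suc (sym (+-suc ⌊ m /2⌋ ⌊ m /2⌋))) (s≤s (n≤1+⌊n/2⌋+⌊n/2⌋ m)))

module GrowthSeries (n : ℕ) (adj : Adjacency n) (L N'' : ℕ)
                    (adj-sym : ∀ u v → adj u v ≡ adj v u) (adj-irrefl : ∀ v → adj v v ≡ false)
                    (regular : IsRegular n adj L) (tri : TriangleFree n adj) where

  N' : ℕ
  N' = suc (suc N'')

  open Geodesics n adj N' adj-sym adj-irrefl

  K : ℕ
  K = ⌊ N /2⌋

  K+1<N : suc K < N
  K+1<N = s≤s (s≤s (s≤s (≤-pred (⌊n/2⌋<n N''))))

  open Recurrences n adj N' adj-sym adj-irrefl tri K (⌊n/2⌋+⌊n/2⌋≤n N) (n≤1+⌊n/2⌋+⌊n/2⌋ N) K+1<N L regular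
  open Balanced tri K (⌊n/2⌋+⌊n/2⌋≤n N) (n≤1+⌊n/2⌋+⌊n/2⌋ N) K+1<N

  count≡countWords : ∀ (p : Word n → Word n) {c} m →
    Count (λ x → length x ≡ m × Geodesic n adj N (p x)) c → c ≡ countWords (λ x → isGeodesic (p x)) m
  count≡countWords p m C =
    Count⇒≡countWords (λ x → isGeodesic (p x)) m C (λ x geo → Equivalence.from T-≡ (Geo⇒isGeodesic (p x) geo))
                                                   (λ x t → isGeodesic⇒Geo (p x) (Equivalence.to T-≡ t))

  ≤⇒≤ᵇ-true : ∀ {k} → k ≤ K → (k ≤ᵇ K) ≡ true
  ≤⇒≤ᵇ-true k≤K = Equivalence.to T-≡ (≤⇒≤ᵇ k≤K)

  ≤ᵇ-true⇒≤ : ∀ {k} → (k ≤ᵇ K) ≡ true → k ≤ K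
  ≤ᵇ-true⇒≤ {k} eq = ≤ᵇ⇒≤ k K (Equivalence.from T-≡ eq)

  module Coefficients
    (g : ℕ → ℕ)
    (g-count : ∀ m → Count (λ w → length w ≡ m × Geodesic n adj N w) (g m))
    (d : Fin n → ℕ → ℕ → ℕ)
    (d-count : ∀ v k m → 1 ≤ k → k ≤ K →
      Count (λ x → length x ≡ m × Geodesic n adj N (pow v k ++ x)) (d v k m))
    (e : Fin n → Fin n → ℕ → ℕ → ℕ → ℕ)
    (e-count : ∀ u v k l m → adj u v ≡ true → 1 ≤ k → k ≤ K → 1 ≤ l → l ≤ K →
      Count (λ x → length x ≡ m × Geodesic n adj N (pow u k ++ pow v l ++ x)) (e u v k l m)) where

    Gser≡ΣΔ : ∀ k m → 1 ≤ k → Gser n K d k m ≡ when (k ≤ᵇ K) (sumFin n (λ v → Δ v k m))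
    Gser≡ΣΔ k m 1≤k with k ≤ᵇ K in k≤K
    ... | true = sumFin-cong n (λ v → count≡countWords (pow v k ++_) m (d-count v k m 1≤k (≤ᵇ-true⇒≤ k≤K)))
    ... | false = refl

    Gpair≡ΣΔ₂ : ∀ k l m → 1 ≤ k → 1 ≤ l → Gpair n adj K e k l m ≡ when ((k ≤ᵇ K) ∧ (l ≤ᵇ K)) (sumEdges (λ u v → Δ₂ u v k l m))
    Gpair≡ΣΔ₂ k l m 1≤k 1≤l with k ≤ᵇ K in k≤K | l ≤ᵇ K in l≤K
    ... | true | true = sumEdges-cong _ _ (λ u v uv →
          count≡countWords (λ x → pow u k ++ pow v l ++ x) m (e-count u v k l m uv 1≤k (≤ᵇ-true⇒≤ k≤K) 1≤l (≤ᵇ-true⇒≤ l≤K)))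
    ... | true | false = refl
    ... | false | _ = refl

    G₁≡ΣΔ : ∀ m → Gser n K d 1 m ≡ sumFin n (λ v → Δ v 1 m)
    G₁≡ΣΔ m = trans (Gser≡ΣΔ 1 m ≤-refl) (cong (λ b → when b (sumFin n (λ v → Δ v 1 m))) (≤⇒≤ᵇ-true (s≤s z≤n)))

    Gk≡ΣΔ : ∀ k m → 1 ≤ k → k ≤ K → Gser n K d k m ≡ sumFin n (λ v → Δ v k m)
    Gk≡ΣΔ k m 1≤k k≤K = trans (Gser≡ΣΔ k m 1≤k) (cong (λ b → when b (sumFin n (λ v → Δ v k m))) (≤⇒≤ᵇ-true k≤K))

    Gkl≡ΣΔ₂ : ∀ k l m → 1 ≤ k → k ≤ K → 1 ≤ l → l ≤ K → Gpair n adj K e k l m ≡ sumEdges (λ u v → Δ₂ u v k l m)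
    Gkl≡ΣΔ₂ k l m 1≤k k≤K 1≤l l≤K =
      trans (Gpair≡ΣΔ₂ k l m 1≤k 1≤l)
            (cong₂ (λ b c → when (b ∧ c) (sumEdges (λ u v → Δ₂ u v k l m))) (≤⇒≤ᵇ-true k≤K) (≤⇒≤ᵇ-true l≤K))

    Gkl-sucˡ : ∀ k l m → l ≤ K → 1 ≤ l →
      Gpair n adj K e (suc k) l m ≡ when (suc k ≤ᵇ K) (sumEdges (λ u v → Δ₂ u v (suc k) l m))
    Gkl-sucˡ k l m l≤K 1≤l =
      trans (Gpair≡ΣΔ₂ (suc k) l m (s≤s z≤n) 1≤l)
            (trans (cong (λ c → when ((suc k ≤ᵇ K) ∧ c) (sumEdges (λ u v → Δ₂ u v (suc k) l m))) (≤⇒≤ᵇ-true l≤K))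
                   (cong (λ b → when b (sumEdges (λ u v → Δ₂ u v (suc k) l m))) (∧-identityʳ (suc k ≤ᵇ K))))

    Gkl-sucʳ : ∀ k l m → k ≤ K → 1 ≤ k →
      Gpair n adj K e k (suc l) m ≡ when (suc l ≤ᵇ K) (sumEdges (λ u v → Δ₂ u v k (suc l) m))
    Gkl-sucʳ k l m k≤K 1≤k =
      trans (Gpair≡ΣΔ₂ k (suc l) m 1≤k (s≤s z≤n))
            (cong (λ b → when (b ∧ (suc l ≤ᵇ K)) (sumEdges (λ u v → Δ₂ u v k (suc l) m))) (≤⇒≤ᵇ-true k≤K))

    growth-zero : g 0 ≡ 1
    growth-zero = count≡countWords (λ x → x) 0 (g-count 0)

    -- a geodesic starts with some w or w⁻¹, and both contribute Δ_w
    growth-suc : ∀ m → g (suc m) ≡ 2 * Gser n K d 1 m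
    growth-suc m =
      trans (count≡countWords (λ x → x) (suc m) (g-count (suc m)))
      (trans (sumFin-cong n (λ w → trans (cong (Δ w 1 m +_) (countWords-gen⁻≡gen⁺ w [] m refl)) (double (Δ w 1 m))))
      (trans (sumFin-*ˡ n 2 (λ w → Δ w 1 m)) (cong (2 *_) (sym (G₁≡ΣΔ m)))))

    Gk-zero : ∀ k → 1 ≤ k → k ≤ K → Gser n K d k 0 ≡ n
    Gk-zero k 1≤k k≤K =
      trans (Gk≡ΣΔ k 0 1≤k k≤K)
      (trans (sumFin-cong n (λ v → cong (λ b → if b then 1 else 0) (isGeodesic-pow v k k≤K)))
             (trans (sumFin-const n 1) (*-identityʳ n)))

    Gk-suc : ∀ k → 1 ≤ k → k ≤ K → ∀ m →
      Gser n K d k (suc m) ≡ Gser n K d (suc k) m + 2 * Gpair n adj K e 1 k m + 2 * (n ∸ L ∸ 1) * Gser n K d 1 m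
    Gk-suc k 1≤k k≤K m =
      trans (Gk≡ΣΔ k (suc m) 1≤k k≤K)
      (trans (ΣΔ-suc k m 1≤k k≤K)
      (sym (cong₂ _+_ (cong₂ _+_ (Gser≡ΣΔ (suc k) m (s≤s z≤n)) (cong (2 *_) (Gkl≡ΣΔ₂ 1 k m ≤-refl (s≤s z≤n) 1≤k k≤K)))
                      (cong (2 * (n ∸ L ∸ 1) *_) (G₁≡ΣΔ m)))))

    Gkl-zero : ∀ k l → 1 ≤ k → k ≤ K → 1 ≤ l → l ≤ K → Gpair n adj K e k l 0 ≡ n * L
    Gkl-zero k l 1≤k k≤K 1≤l l≤K =
      trans (Gkl≡ΣΔ₂ k l 0 1≤k k≤K 1≤l l≤K)
      (trans (sumEdges-cong _ (λ _ _ → 1) (λ u v uv → cong (λ b → if b then 1 else 0) (isGeodesic-pow-pow u v k l uv k≤K l≤K)))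
      (trans (sumFin-cong n regular) (sumFin-const n L)))

    Gkl-suc : ∀ k l → 1 ≤ k → k ≤ K → 1 ≤ l → l ≤ K → ∀ m →
      Gpair n adj K e k l (suc m) ≡
        Gpair n adj K e (suc k) l m + Gpair n adj K e k (suc l) m
        + 2 * (L ∸ 1) * (Gpair n adj K e 1 k m + Gpair n adj K e 1 l m)
        + 2 * L * (n ∸ 2 * L) * Gser n K d 1 m
    Gkl-suc k l 1≤k k≤K 1≤l l≤K m =
      trans (Gkl≡ΣΔ₂ k l (suc m) 1≤k k≤K 1≤l l≤K)
      (trans (ΣΔ₂-suc k l m 1≤k k≤K 1≤l l≤K)
      (sym (cong₂ _+_ (cong₂ _+_ (cong₂ _+_ (Gkl-sucˡ k l m l≤K 1≤l) (Gkl-sucʳ k l m k≤K 1≤k))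
                                 (cong (2 * (L ∸ 1) *_) (cong₂ _+_ (Gkl≡ΣΔ₂ 1 k m ≤-refl (s≤s z≤n) 1≤k k≤K)
                                                                   (Gkl≡ΣΔ₂ 1 l m ≤-refl (s≤s z≤n) 1≤l l≤K))))
                      (cong (2 * L * (n ∸ 2 * L) *_) (G₁≡ΣΔ m)))))

theorem7p1 :
    (n : ℕ) (adj : Adjacency n) (L N : ℕ) →
    IsSimple n adj → IsRegular n adj L → TriangleFree n adj → 3 ≤ N →
    (g : ℕ → ℕ) →
    (∀ m → Count (λ w → length w ≡ m × Geodesic n adj N w) (g m)) →
    (d : Fin n → ℕ → ℕ → ℕ) →
    (∀ v k m → 1 ≤ k → k ≤ ⌊ N /2⌋ →
      Count (λ x → length x ≡ m × Geodesic n adj N (pow v k ++ x)) (d v k m)) →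
    (e : Fin n → Fin n → ℕ → ℕ → ℕ → ℕ) →
    (∀ u v k l m → adj u v ≡ true → 1 ≤ k → k ≤ ⌊ N /2⌋ → 1 ≤ l → l ≤ ⌊ N /2⌋ →
      Count (λ x → length x ≡ m × Geodesic n adj N (pow u k ++ pow v l ++ x))
            (e u v k l m)) →
    let K = ⌊ N /2⌋
        G₁ = Gser n K d 1
        Gk = Gser n K d
        Gkl = Gpair n adj K e
    in
    (g 0 ≡ 1 × (∀ m → g (suc m) ≡ 2 * G₁ m)) ×
    (∀ k → 1 ≤ k → k ≤ K →
      Gk k 0 ≡ n ×
      (∀ m → Gk k (suc m) ≡
         Gk (suc k) m + 2 * Gkl 1 k m + 2 * (n ∸ L ∸ 1) * G₁ m)) ×
    (∀ k l → 1 ≤ k → k ≤ K → 1 ≤ l → l ≤ K →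
      Gkl k l 0 ≡ n * L ×
      (∀ m → Gkl k l (suc m) ≡
         Gkl (suc k) l m + Gkl k (suc l) m
         + 2 * (L ∸ 1) * (Gkl 1 k m + Gkl 1 l m)
         + 2 * L * (n ∸ 2 * L) * G₁ m))
theorem7p1 n adj L (suc (suc (suc N''))) (adj-sym , adj-irrefl) regular tri (s≤s (s≤s (s≤s _))) g g-count d d-count e e-count =
  (growth-zero , growth-suc) ,
  (λ k 1≤k k≤K → Gk-zero k 1≤k k≤K , Gk-suc k 1≤k k≤K) ,
  (λ k l 1≤k k≤K 1≤l l≤K → Gkl-zero k l 1≤k k≤K 1≤l l≤K , Gkl-suc k l 1≤k k≤K 1≤l l≤K)
  where
  open GrowthSeries n adj L N'' adj-sym adj-irrefl regular tri
  open Coefficients g g-count d d-count e e-count
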